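{- Let $B\ge1$ be an integer and let $0<\theta<1$ be irrational with partial quotients bounded by $B$. Let ${\bf s}=(s_i)_{i\ge0}$ with $s_i=\lfloor (i+2)\theta\rfloor-\lfloor (i+1)\theta\rfloor$. Then the function $r\mapsto 2(B+2)^2r^2$ is a diversity measure for ${\bf s}$; that is, for all integers $r,a,b$ with $0\le a<b<r$, the sequences $(s_{ri+a})_{i\ge0}$ and $(s_{ri+b})_{i\ge0}$ are distinct and $\min\{i: s_{ri+a}\ne s_{ri+b}\}\le 2(B+2)^2r^2$.
   Context: $\theta=[a_0;a_1,\ldots]$ has partial quotients bounded by $B$ if $|a_i|\le B$ for all $i\ge1$. For distinct sequences ${\bf t},{\bf u}$ the agreement is ${\rm ag}({\bf t},{\bf u})=\min\{i:t_i\ne u_i\}$; a function $g$ is a diversity measure for ${\bf s}$ if for all $r,a,b$ with $0\le a<b<r$, ${\rm ag}((s_{ri+a})_{i\ge0},(s_{ri+b})_{i\ge0})\le g(r)$. -}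

module Defs where

open import Data.Nat using (ℕ; zero; suc; _+_; _*_; _∸_; _≤_; _<_; _≤ᵇ_; _<ᵇ_; _≡ᵇ_)
open import Data.Nat.DivMod using (_/_; _%_)
open import Data.Bool using (Bool; true; false; not; if_then_else_)
open import Data.Product using (Σ; _×_)
open import Relation.Binary.PropositionalEquality using (_≢_)

-- An irrational θ ∈ (0,1) is represented by its (infinite) continued fraction
-- expansion θ = [0; a₁, a₂, …], given as a digit sequence  cf : ℕ → ℕ  with
-- cf i = a_{i+1}, every digit ≥ 1.  (This is a bijection between such
-- sequences and the irrationals in (0,1).)
IsCF : (ℕ → ℕ) → Set
IsCF cf = ∀ i → 1 ≤ cf i

BoundedPQ : ℕ → (ℕ → ℕ) → Set
BoundedPQ B cf = ∀ i → cf i ≤ B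

shift : (ℕ → ℕ) → (ℕ → ℕ)
shift cf i = cf (suc i)

-- ltθ fuel cf m n  decides  m / n < θ  for θ = [0; cf 0, cf 1, …]  (n ≥ 1),
-- by the continued-fraction (Euclidean) comparison:
--   m = 0      : 0 < θ
--   m ≥ n      : m/n ≥ 1 > θ
--   otherwise  : 1/(m/n) = q + rem/m  with q = n / m, rem = n % m,
--                1/θ = cf 0 + θ'  with θ' = [0; cf 1, …] ∈ (0,1);
--                q < cf 0 ⇒ false ; q > cf 0 ⇒ true ;
--                q = cf 0 ⇒ (rem = 0 ⇒ false ; else not (rem/m < θ')).
-- The fuel m suffices since the numerator strictly decreases.
ltθ : ℕ → (ℕ → ℕ) → ℕ → ℕ → Bool
ltθ _        cf zero    n = true
ltθ zero     cf (suc k) n = false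
ltθ (suc f)  cf (suc k) n =
  if n ≤ᵇ suc k then false
  else (let q = n / suc k ; rem = n % suc k in
        if q <ᵇ cf 0 then false
        else if cf 0 <ᵇ q then true
        else if rem ≡ᵇ 0 then false
        else not (ltθ f (shift cf) rem (suc k)))

countBelow : (ℕ → ℕ) → ℕ → ℕ → ℕ
countBelow cf n zero    = 0
countBelow cf n (suc k) =
  (if ltθ (suc k) cf (suc k) n then 1 else 0) + countBelow cf n k

-- ⌊ n θ ⌋  = #{ m ≥ 1 : m < nθ } = #{ m ∈ {1,…,n} : m/n < θ }  (θ irrational, 0<θ<1)
floorMul : (ℕ → ℕ) → ℕ → ℕ
floorMul cf n = countBelow cf n n

sturm : (ℕ → ℕ) → ℕ → ℕ
sturm cf i = floorMul cf (i + 2) ∸ floorMul cf (i + 1)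

IsDiversityMeasure : (ℕ → ℕ) → (ℕ → ℕ) → Set
IsDiversityMeasure g s =
  ∀ r a b → a < b → b < r →
  Σ ℕ (λ i → i ≤ g r × s (r * i + a) ≢ s (r * i + b))

{-# OPTIONS --safe #-}
module Submission where

-- Real inequalities about θ become integer ones: a linear form x θ + y is positive iff
-- x p + y q > 0 for all late convergents p / q of θ.  Let d = b − a and D = (B + 2) d.
-- Bounded partial quotients give |d′ θ − e| > 1 / ((B + 2) d′) for all d′ ≥ 1 and e, because
-- |d′ θ − e| ≥ |q_J θ − p_J| when q_J ≤ d′ < q_{J+1}, and (B + 2) q_J |q_J θ − p_J| > 1.  So θ
-- and δ = {d θ} stay at distance > 1 / D from the integers.  As s_n = 1 exactly when
-- {(n + 1) θ} ≥ 1 − θ, placing {(n + 1) θ} in a window of length 1 / D just above 0 (if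
-- δ + θ ≥ 1) or just below 1 (otherwise) forces s_n ≠ s_{n+d}.  Finally some i < q_K with
-- q_K ≤ 2 (B + 2)² r² puts {(r i + a + 1) θ} in that window: i ↦ i p_K is a bijection modulo
-- q_K, and i θ differs from i p_K / q_K by less than 1 / q_{K+1}.

open import Defs
open import Data.Nat using (ℕ)
open import Data.Integer using (ℤ)

module Convergents where

  open import Data.Nat
  open import Data.Nat.Properties
  open import Relation.Binary.PropositionalEquality
  open import Data.Nat.Tactic.RingSolver using (solve-∀)
  open import Data.Product using (Σ; _×_; _,_)
  open import Relation.Nullary using (yes; no; contradiction)

  continuant : (ℕ → ℕ) → ℕ → ℕ → ℕ → ℕ
  continuant cf u v zero    = u
  continuant cf u v (suc k) = continuant (shift cf) v (cf 0 * v + u) k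

  -- numer cf (1 + k) / denom cf (1 + k) is the convergent [0; cf 0, …, cf (k ∸ 1)];
  -- index 0 gives 1 / 0.
  numer denom : (ℕ → ℕ) → ℕ → ℕ
  numer cf = continuant cf 1 0
  denom cf = continuant cf 0 1

  IsCF-shift : ∀ {cf} → IsCF cf → IsCF (shift cf)
  IsCF-shift icf i = icf (suc i)

  continuant-linear : ∀ cf u v k → continuant cf u v k ≡ u * numer cf k + v * denom cf k
  continuant-linear cf u v zero = unit u v
    where
    unit : ∀ u v → u ≡ u * 1 + v * 0
    unit = solve-∀
  continuant-linear cf u v (suc k) = begin
    continuant cf′ v (a * v + u) k
      ≡⟨ continuant-linear cf′ v (a * v + u) k ⟩
    v * P + (a * v + u) * Q
      ≡⟨ regroup u v a P Q ⟩
    u * (0 * P + (a * 0 + 1) * Q) + v * (1 * P + (a * 1 + 0) * Q)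
      ≡⟨ sym (cong₂ (λ x y → u * x + v * y) (continuant-linear cf′ 0 _ k) (continuant-linear cf′ 1 _ k)) ⟩
    u * numer cf (suc k) + v * denom cf (suc k) ∎
    where
    open ≡-Reasoning
    cf′ = shift cf
    a = cf 0
    P = numer cf′ k
    Q = denom cf′ k
    regroup : ∀ u v a P Q → v * P + (a * v + u) * Q ≡ u * (0 * P + (a * 0 + 1) * Q) + v * (1 * P + (a * 1 + 0) * Q)
    regroup = solve-∀

  numer-suc : ∀ cf k → numer cf (suc k) ≡ denom (shift cf) k
  numer-suc cf k = cong (λ x → continuant (shift cf) 0 (x + 1) k) (*-zeroʳ (cf 0))

  denom-suc : ∀ cf k → denom cf (suc k) ≡ numer (shift cf) k + cf 0 * denom (shift cf) k
  denom-suc cf k = trans (continuant-linear (shift cf) 1 (cf 0 * 1 + 0) k) (simplify (cf 0) _ _)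
    where
    simplify : ∀ a P Q → 1 * P + (a * 1 + 0) * Q ≡ P + a * Q
    simplify = solve-∀

  continuant-rec : ∀ cf u v k →
    continuant cf u v (2 + k) ≡ cf k * continuant cf u v (1 + k) + continuant cf u v k
  continuant-rec cf u v zero    = refl
  continuant-rec cf u v (suc k) = continuant-rec (shift cf) v (cf 0 * v + u) k

  module _ {cf : ℕ → ℕ} (icf : IsCF cf) where

    private
      m≤cf*m : ∀ k m → m ≤ cf k * m
      m≤cf*m k m = m≤n*m m (cf k) ⦃ >-nonZero (icf k) ⦄

    continuant-mono : ∀ u v k → continuant cf u v (1 + k) ≤ continuant cf u v (2 + k)
    continuant-mono u v k = begin
      continuant cf u v (1 + k)                                  ≤⟨ m≤cf*m k _ ⟩
      cf k * continuant cf u v (1 + k)                           ≤⟨ m≤m+n _ _ ⟩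
      cf k * continuant cf u v (1 + k) + continuant cf u v k     ≡⟨ continuant-rec cf u v k ⟨
      continuant cf u v (2 + k)                                  ∎
      where open ≤-Reasoning

    denom-pos : ∀ k → 1 ≤ denom cf (1 + k)
    denom-pos zero    = ≤-refl
    denom-pos (suc k) = ≤-trans (denom-pos k) (continuant-mono 0 1 k)

    numer-pos : ∀ k → 1 ≤ numer cf (2 + k)
    numer-pos zero    = m≤n+m 1 (cf 0 * 0)
    numer-pos (suc k) = ≤-trans (numer-pos k) (continuant-mono 1 0 (1 + k))

    denom-mono : ∀ k → denom cf k ≤ denom cf (1 + k)
    denom-mono zero    = z≤n
    denom-mono (suc k) = continuant-mono 0 1 k

    ≤denom : ∀ k → k ≤ denom cf (1 + k)
    ≤denom zero          = z≤n
    ≤denom (suc zero)    = denom-pos 1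
    ≤denom (suc (suc k)) = begin
      2 + k                                     ≡⟨ +-comm 1 (1 + k) ⟩
      (1 + k) + 1                               ≤⟨ +-mono-≤ (≤-trans (≤denom (suc k)) (m≤cf*m (1 + k) _)) (denom-pos k) ⟩
      cf (1 + k) * denom cf (2 + k) + denom cf (1 + k) ≡⟨ continuant-rec cf 0 1 (1 + k) ⟨
      denom cf (3 + k)                          ∎
      where open ≤-Reasoning

    denom-bounded : ∀ B → BoundedPQ B cf → ∀ k → denom cf (2 + k) ≤ (B + 1) * denom cf (1 + k)
    denom-bounded B bnd k = begin
      denom cf (2 + k)                          ≡⟨ continuant-rec cf 0 1 k ⟩
      cf k * denom cf (1 + k) + denom cf k      ≤⟨ +-mono-≤ (*-monoˡ-≤ _ (bnd k)) (denom-mono k) ⟩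
      B * denom cf (1 + k) + denom cf (1 + k)   ≡⟨ distrib B _ ⟩
      (B + 1) * denom cf (1 + k)                ∎
      where
      open ≤-Reasoning
      distrib : ∀ B x → B * x + x ≡ (B + 1) * x
      distrib = solve-∀

  numer<denom : ∀ {cf} → IsCF cf → ∀ k → numer cf (3 + k) < denom cf (3 + k)
  numer<denom {cf} icf k = begin-strict
    numer cf (3 + k)                           ≡⟨ numer-suc cf (2 + k) ⟩
    Q                                          <⟨ m<n+m Q (numer-pos (IsCF-shift icf) k) ⟩
    P + Q                                      ≤⟨ +-monoʳ-≤ P (m≤n*m Q (cf 0) ⦃ >-nonZero (icf 0) ⦄) ⟩
    P + cf 0 * Q                               ≡⟨ denom-suc cf (2 + k) ⟨
    denom cf (3 + k)                           ∎
    where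
    open ≤-Reasoning
    P = numer (shift cf) (2 + k)
    Q = denom (shift cf) (2 + k)

  denom-bracket : ∀ {cf} → IsCF cf → ∀ {M} → 1 ≤ M → Σ ℕ λ j → denom cf (1 + j) ≤ M × M < denom cf (2 + j)
  denom-bracket {cf} icf {M} M≥1 = search (suc M) 0 M≥1 (≤denom icf (suc M))
    where
    search : ∀ fuel j → denom cf (1 + j) ≤ M → M < denom cf (1 + j + fuel) →
             Σ ℕ λ j → denom cf (1 + j) ≤ M × M < denom cf (2 + j)
    search zero       j q≤M M<q = contradiction q≤M (<⇒≱ (subst (λ i → M < denom cf i) (+-identityʳ (1 + j)) M<q))
    search (suc fuel) j q≤M M<q with M <? denom cf (2 + j)
    ... | yes M<q′ = j , q≤M , M<q′
    ... | no  M≮q′ = search fuel (suc j) (≮⇒≥ M≮q′) (subst (λ i → M < denom cf i) (+-suc (1 + j) fuel) M<q)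

module Eventually where

  open import Data.Nat
  open import Data.Nat.Properties
  open import Data.Product using (Σ; _×_; _,_)
  open import Relation.Binary.PropositionalEquality

  Eventually : (ℕ → Set) → Set
  Eventually P = Σ ℕ λ K → ∀ k → K ≤ k → P k

  module _ {P : ℕ → Set} where

    eventually-from : ∀ K → (∀ k → P (K + k)) → Eventually P
    eventually-from K h = K , λ k K≤k → subst P (m+[n∸m]≡n K≤k) (h (k ∸ K))

    eventually-shift : Eventually (λ k → P (suc k)) → Eventually P
    eventually-shift (K , h) = eventually-from (suc K) λ k → h (K + k) (m≤m+n K k)

    eventually-witness : Eventually P → Σ ℕ P
    eventually-witness (K , h) = K , h K ≤-refl

    module _ {R : ℕ → Set} where

      eventually-map : (∀ k → P k → R k) → Eventually P → Eventually R
      eventually-map f (K , h) = K , λ k K≤k → f k (h k K≤k)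

      eventually-zip : Eventually P → Eventually R → Eventually (λ k → P k × R k)
      eventually-zip (K , h) (L , g) =
        K ⊔ L , λ k le → h k (≤-trans (m≤m⊔n K L) le) , g k (≤-trans (m≤n⊔m K L) le)

module Comparison where

  open import Data.Nat
  open import Data.Nat.Properties
  open import Data.Nat.DivMod using (m≡m%n+[m/n]*n; m%n<n)
  open import Data.Bool using (Bool; true; false; not; T)
  open import Data.Bool.Properties using (T-≡)
  open import Data.Product using (Σ; _×_; _,_)
  open import Function.Bundles using (Equivalence)
  open import Relation.Binary.PropositionalEquality
  open import Relation.Nullary using (contradiction)
  open import Data.Nat.Tactic.RingSolver using (solve-∀)
  open Convergents
  open Eventually

  Below Above : (ℕ → ℕ) → ℕ → ℕ → Set
  Below cf m n = Eventually λ k → m * denom cf k < n * numer cf k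
  Above cf m n = Eventually λ k → n * numer cf k < m * denom cf k

  Compare : (ℕ → ℕ) → ℕ → ℕ → Bool → Set
  Compare cf m n true  = Below cf m n
  Compare cf m n false = Above cf m n

  private
    fromT : ∀ {b} → b ≡ true → T b
    fromT = Equivalence.from T-≡

    ≡-of-≮ᵇ : ∀ {x y} → (x <ᵇ y) ≡ false → (y <ᵇ x) ≡ false → x ≡ y
    ≡-of-≮ᵇ x≮y y≮x = ≤-antisym (≮⇒≥ (refute y≮x)) (≮⇒≥ (refute x≮y))
      where
      refute : ∀ {u v} → (u <ᵇ v) ≡ false → u ≮ v
      refute u≮v u<v = subst T u≮v (<⇒<ᵇ u<v)

    div-≡ : ∀ n m .{{_ : NonZero m}} {q} → n / m ≡ q → n ≡ n % m + q * m
    div-≡ n m refl = m≡m%n+[m/n]*n n m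

  module _ {cf : ℕ → ℕ} (icf : IsCF cf) where

    private
      a = cf 0
      P Q : ℕ → ℕ
      P = numer (shift cf)
      Q = denom (shift cf)

      numer-step : ∀ n k → n * numer cf (suc k) ≡ n * Q k
      numer-step n k = cong (n *_) (numer-suc cf k)

      denom-step : ∀ m k → m * denom cf (suc k) ≡ m * P k + a * m * Q k
      denom-step m k = trans (cong (m *_) (denom-suc cf k)) (distrib m (P k) a (Q k))
        where
        distrib : ∀ m P a Q → m * (P + a * Q) ≡ m * P + a * m * Q
        distrib = solve-∀

      split-step : ∀ {n rem m} → n ≡ rem + a * m → ∀ k → n * Q k ≡ rem * Q k + a * m * Q k
      split-step {rem = rem} {m} refl k = *-distribʳ-+ (Q k) rem (a * m)

    zero-below : ∀ {n} → 1 ≤ n → Below cf 0 n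
    zero-below n≥1 = eventually-from 2 λ k → *-mono-≤ n≥1 (numer-pos icf k)

    one-above : ∀ {n} → 1 ≤ n → Above cf n n
    one-above {n@(suc _)} _ = eventually-from 3 λ k → *-monoʳ-< n (numer<denom icf k)

    above-of-≤ : ∀ {m n} → 1 ≤ m → n ≤ a * m → Above cf m n
    above-of-≤ {m} {n} m≥1 n≤am = eventually-from 3 λ k → begin-strict
      n * numer cf (3 + k)               ≡⟨ numer-step n (2 + k) ⟩
      n * Q (2 + k)                      ≤⟨ *-monoˡ-≤ _ n≤am ⟩
      a * m * Q (2 + k)                  <⟨ m<n+m _ (*-mono-≤ m≥1 (numer-pos (IsCF-shift icf) k)) ⟩
      m * P (2 + k) + a * m * Q (2 + k)  ≡⟨ denom-step m (2 + k) ⟨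
      m * denom cf (3 + k)               ∎
      where open ≤-Reasoning

    below-of-≥ : ∀ {m n} → 1 ≤ m → (1 + a) * m ≤ n → Below cf m n
    below-of-≥ {m} {n} m≥1 [1+a]m≤n = eventually-from 4 λ k → begin-strict
      m * denom cf (4 + k)               ≡⟨ denom-step m (3 + k) ⟩
      m * P (3 + k) + a * m * Q (3 + k)  <⟨ +-monoˡ-< _ (*-monoʳ-< m ⦃ >-nonZero m≥1 ⦄ (numer<denom (IsCF-shift icf) k)) ⟩
      m * Q (3 + k) + a * m * Q (3 + k)  ≡⟨ *-distribʳ-+ (Q (3 + k)) m (a * m) ⟨
      (1 + a) * m * Q (3 + k)            ≤⟨ *-monoˡ-≤ _ [1+a]m≤n ⟩
      n * Q (3 + k)                      ≡⟨ numer-step n (3 + k) ⟨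
      n * numer cf (4 + k)               ∎
      where open ≤-Reasoning

    below-of-above : ∀ {m n rem} → n ≡ rem + a * m → Above (shift cf) rem m → Below cf m n
    below-of-above {m} {n} {rem} n≡ above = eventually-shift (eventually-map step above)
      where
      step : ∀ k → m * P k < rem * Q k → m * denom cf (suc k) < n * numer cf (suc k)
      step k h = subst₂ _<_ (sym (denom-step m k)) (sym (trans (numer-step n k) (split-step n≡ k)))
                     (+-monoˡ-< (a * m * Q k) h)

    above-of-below : ∀ {m n rem} → n ≡ rem + a * m → Below (shift cf) rem m → Above cf m n
    above-of-below {m} {n} {rem} n≡ below = eventually-shift (eventually-map step below)
      where
      step : ∀ k → rem * Q k < m * P k → n * numer cf (suc k) < m * denom cf (suc k)
      step k h = subst₂ _<_ (sym (trans (numer-step n k) (split-step n≡ k))) (sym (denom-step m k))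
                     (+-monoˡ-< (a * m * Q k) h)

    below-above-< : ∀ {j j′ n} → Below cf j n → Above cf j′ n → j < j′
    below-above-< {j} {j′} below above with eventually-witness (eventually-zip below above)
    ... | k , (jq<np , np<j′q) = *-cancelʳ-< (denom cf k) j j′ (<-trans jq<np np<j′q)

    compare-not : ∀ {m n rem} → n ≡ rem + a * m → ∀ b → Compare (shift cf) rem m b → Compare cf m n (not b)
    compare-not n≡ true  = above-of-below n≡
    compare-not n≡ false = below-of-above n≡

  ltθ-sound : ∀ {cf} → IsCF cf → ∀ f m n → m ≤ f → 1 ≤ n → Compare cf m n (ltθ f cf m n)
  ltθ-sound icf f zero n _ n≥1 = zero-below icf n≥1
  ltθ-sound {cf} icf (suc f) m@(suc _) n (s≤s m-1≤f) n≥1 with n ≤ᵇ m in n≤m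
  ... | true = above-of-≤ icf z<s (≤-trans (≤ᵇ⇒≤ n m (fromT n≤m)) (m≤n*m m (cf 0) ⦃ >-nonZero (icf 0) ⦄))
  ... | false with n / m <ᵇ cf 0 in q<a
  ...   | true = above-of-≤ icf z<s (begin
          n                  ≡⟨ m≡m%n+[m/n]*n n m ⟩
          n % m + n / m * m  ≤⟨ +-monoˡ-≤ (n / m * m) (<⇒≤ (m%n<n n m)) ⟩
          suc (n / m) * m    ≤⟨ *-monoˡ-≤ m (<ᵇ⇒< (n / m) (cf 0) (fromT q<a)) ⟩
          cf 0 * m           ∎)
    where open ≤-Reasoning
  ...   | false with cf 0 <ᵇ n / m in a<q
  ...     | true = below-of-≥ icf z<s (begin
            (1 + cf 0) * m     ≤⟨ *-monoˡ-≤ m (<ᵇ⇒< (cf 0) (n / m) (fromT a<q)) ⟩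
            n / m * m          ≤⟨ m≤n+m (n / m * m) (n % m) ⟩
            n % m + n / m * m  ≡⟨ m≡m%n+[m/n]*n n m ⟨
            n                  ∎)
    where open ≤-Reasoning
  ...     | false with n % m ≡ᵇ 0 in rem≡0
  ...       | true = above-of-≤ icf z<s (≤-reflexive (trans (div-≡ n m (≡-of-≮ᵇ q<a a<q))
                       (cong (_+ cf 0 * m) (≡ᵇ⇒≡ (n % m) 0 (fromT rem≡0)))))
  ...       | false = compare-not icf (div-≡ n m (≡-of-≮ᵇ q<a a<q)) (ltθ f (shift cf) (n % m) m)
                        (ltθ-sound (IsCF-shift icf) f (n % m) m (≤-pred (≤-trans (m%n<n n m) (s≤s m-1≤f))) z<s)

  module _ {cf : ℕ → ℕ} (icf : IsCF cf) {N : ℕ} (N≥1 : 1 ≤ N) where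

    private
      below⇒< : ∀ {i} → Below cf i N → i < N
      below⇒< below = below-above-< icf {n = N} below (one-above icf N≥1)

      sound : ∀ i → Compare cf (suc i) N (ltθ (suc i) cf (suc i) N)
      sound i = ltθ-sound icf (suc i) (suc i) N ≤-refl N≥1

    floor-bracket : Σ ℕ λ m → Below cf m N × Above cf (suc m) N
    floor-bracket = search N 0 ≤-refl (zero-below icf N≥1)
      where
      search : ∀ fuel i → N ≤ i + fuel → Below cf i N → Σ ℕ λ m → Below cf m N × Above cf (suc m) N
      search zero i N≤i below = contradiction (below⇒< below) (≤⇒≯ (subst (N ≤_) (+-identityʳ i) N≤i))
      search (suc fuel) i N≤ below with ltθ (suc i) cf (suc i) N | sound i
      ... | true  | below′ = search fuel (suc i) (subst (N ≤_) (+-suc i fuel) N≤) below′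
      ... | false | above′ = i , below , above′

    countBelow-≡ : ∀ {m} → Below cf m N → Above cf (suc m) N → ∀ k → countBelow cf N k ≡ k ⊓ m
    countBelow-≡ _ _ zero = refl
    countBelow-≡ {m} below above (suc k) with ltθ (suc k) cf (suc k) N | sound k
    ... | true  | below′ = begin
      suc (countBelow cf N k)  ≡⟨ cong suc (countBelow-≡ below above k) ⟩
      suc (k ⊓ m)              ≡⟨ cong suc (m≤n⇒m⊓n≡m (<⇒≤ k<m)) ⟩
      suc k                    ≡⟨ m≤n⇒m⊓n≡m k<m ⟨
      suc k ⊓ m                ∎
      where
      open ≡-Reasoning
      k<m = ≤-pred (below-above-< icf {n = N} below′ above)
    ... | false | above′ = begin
      countBelow cf N k        ≡⟨ countBelow-≡ below above k ⟩
      k ⊓ m                    ≡⟨ m≥n⇒m⊓n≡n m≤k ⟩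
      m                        ≡⟨ m≥n⇒m⊓n≡n (m≤n⇒m≤1+n m≤k) ⟨
      suc k ⊓ m                ∎
      where
      open ≡-Reasoning
      m≤k = ≤-pred (below-above-< icf {n = N} below above′)

    floorMul-spec : Below cf (floorMul cf N) N × Above cf (suc (floorMul cf N)) N
    floorMul-spec with floor-bracket
    ... | m , below , above = subst (λ x → Below cf x N × Above cf (suc x) N) (sym floor≡m) (below , above)
      where
      floor≡m : countBelow cf N N ≡ m
      floor≡m = trans (countBelow-≡ below above N) (m≥n⇒m⊓n≡n (<⇒≤ (below⇒< below)))

module Sign where

  open import Data.Nat as ℕ using (z≤n; z<s)
  open import Data.Integer
  open import Data.Integer.Properties
  open import Relation.Binary.PropositionalEquality

  0<* : ∀ {a b} → 0ℤ < a → 0ℤ < b → 0ℤ < a * b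
  0<* {+[1+ _ ]} {+[1+ _ ]} _ _ = +<+ z<s
  0<* {+0} (+<+ ())
  0<* {+[1+ _ ]} {+0} _ (+<+ ())

  0≤* : ∀ {a b} → 0ℤ ≤ a → 0ℤ ≤ b → 0ℤ ≤ a * b
  0≤* {+ m} {+ n} _ _ = subst (0ℤ ≤_) (pos-* m n) (+≤+ z≤n)

  0<*⁻¹ : ∀ {a b} → 0ℤ < a → 0ℤ < a * b → 0ℤ < b
  0<*⁻¹ {a} {b} 0<a 0<ab = *-cancelˡ-<-nonNeg a ⦃ nonNegative (<⇒≤ 0<a) ⦄ (subst (_< a * b) (sym (*-zeroʳ a)) 0<ab)

  0<-of-< : ∀ {i j} → i < j → 0ℤ < j - i
  0<-of-< {i} {j} i<j = subst (_< j - i) (+-inverseʳ i) (+-monoˡ-< (- i) i<j)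

  0≤-of-0<+1 : ∀ x → 0ℤ < x + 1ℤ → 0ℤ ≤ x
  0≤-of-0<+1 (+ n)             _       = +≤+ z≤n
  0≤-of-0<+1 -[1+ ℕ.zero ]     (+<+ ())
  0≤-of-0<+1 -[1+ ℕ.suc n ]    ()

-- A form f stands for the real number f θ 1.  It is called positive when it is positive at
-- (numer cf k, denom cf k) for all large k; for a linear form x θ + y with (x, y) ≠ 0 this
-- says exactly that x θ + y > 0, as the convergents tend to the irrational θ.
Form : Set
Form = ℤ → ℤ → ℤ

module Forms {cf : ℕ → ℕ} (icf : IsCF cf) where

  open import Data.Nat as ℕ using (z≤n; s≤s)
  import Data.Nat.Properties as ℕ
  open import Data.Integer hiding (suc)
  open import Data.Integer.Properties
  open import Data.Product using (Σ; _×_; _,_)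
  open import Data.Sum using (_⊎_; inj₁; inj₂)
  open import Data.List using (_∷_; [])
  open import Relation.Nullary using (¬_)
  open import Relation.Binary.PropositionalEquality
  open import Data.Integer.Tactic.RingSolver using (solve; solve-∀)
  open Convergents
  open Eventually
  open Comparison using (Below; Above; floorMul-spec)
  open Sign

  _≐_ : Form → Form → Set
  f ≐ g = ∀ θ 𝟙 → f θ 𝟙 ≡ g θ 𝟙

  record Pos (f : Form) : Set where
    constructor mkPos
    field eventually-pos : Eventually λ k → 0ℤ < f (+ numer cf k) (+ denom cf k)

  record NonNeg (f : Form) : Set where
    constructor mkNonNeg
    field eventually-nonNeg : Eventually λ k → 0ℤ ≤ f (+ numer cf k) (+ denom cf k)

  module _ {f : Form} where

    pos-resp : ∀ {g} → Pos f → f ≐ g → Pos g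
    pos-resp (mkPos h) f≐g = mkPos (eventually-map (λ k → subst (0ℤ <_) (f≐g _ _)) h)

    nonNeg-resp : ∀ {g} → NonNeg f → f ≐ g → NonNeg g
    nonNeg-resp (mkNonNeg h) f≐g = mkNonNeg (eventually-map (λ k → subst (0ℤ ≤_) (f≐g _ _)) h)

    pos⇒nonNeg : Pos f → NonNeg f
    pos⇒nonNeg (mkPos h) = mkNonNeg (eventually-map (λ k → <⇒≤) h)

    pos+nonNeg : ∀ {g} → Pos f → NonNeg g → Pos (λ θ 𝟙 → f θ 𝟙 + g θ 𝟙)
    pos+nonNeg (mkPos h) (mkNonNeg h′) = mkPos (eventually-map (λ k (p , q) → +-mono-<-≤ p q) (eventually-zip h h′))

    nonNeg+nonNeg : ∀ {g} → NonNeg f → NonNeg g → NonNeg (λ θ 𝟙 → f θ 𝟙 + g θ 𝟙)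
    nonNeg+nonNeg (mkNonNeg h) (mkNonNeg h′) = mkNonNeg (eventually-map (λ k (p , q) → +-mono-≤ p q) (eventually-zip h h′))

    pos-scale : ∀ {c} → 0ℤ < c → Pos f → Pos (λ θ 𝟙 → c * f θ 𝟙)
    pos-scale 0<c (mkPos h) = mkPos (eventually-map (λ k → 0<* 0<c) h)

    nonNeg-scale : ∀ {c} → 0ℤ ≤ c → NonNeg f → NonNeg (λ θ 𝟙 → c * f θ 𝟙)
    nonNeg-scale 0≤c (mkNonNeg h) = mkNonNeg (eventually-map (λ k → 0≤* 0≤c) h)

    pos-unscale : ∀ {c} → 0ℤ < c → Pos (λ θ 𝟙 → c * f θ 𝟙) → Pos f
    pos-unscale 0<c (mkPos h) = mkPos (eventually-map (λ k → 0<*⁻¹ 0<c) h)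

    pos⇒¬nonNeg-neg : Pos f → ¬ NonNeg (λ θ 𝟙 → - f θ 𝟙)
    pos⇒¬nonNeg-neg (mkPos h) (mkNonNeg h′) with eventually-witness (eventually-zip h h′)
    ... | k , (0<x , 0≤-x) = <-irrefl refl (<-≤-trans 0<x (subst (_≤ 0ℤ) (neg-involutive x) (neg-mono-≤ 0≤-x)))
      where x = f (+ numer cf k) (+ denom cf k)

  private
    0<-of-ℕ< : ∀ {a b c d} → a ℕ.* b ℕ.< c ℕ.* d → 0ℤ < + c * + d - + a * + b
    0<-of-ℕ< {a} {b} {c} {d} h = subst₂ (λ u v → 0ℤ < u - v) (pos-* c d) (pos-* a b) (0<-of-< (+<+ h))

  pos-𝟙 : Pos (λ θ 𝟙 → 𝟙)
  pos-𝟙 = mkPos (eventually-from 1 λ k → +<+ (denom-pos icf k))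

  pos-θ : Pos (λ θ 𝟙 → θ)
  pos-θ = mkPos (eventually-from 2 λ k → +<+ (numer-pos icf k))

  pos-𝟙-θ : Pos (λ θ 𝟙 → 𝟙 - θ)
  pos-𝟙-θ = mkPos (eventually-from 3 λ k → 0<-of-< (+<+ (numer<denom icf k)))

  pos-const : ∀ {c} → 0ℤ < c → Pos (λ θ 𝟙 → c * 𝟙)
  pos-const 0<c = pos-scale 0<c pos-𝟙

  nonNeg-const : ∀ {c} → 0ℤ ≤ c → NonNeg (λ θ 𝟙 → c * 𝟙)
  nonNeg-const 0≤c = nonNeg-scale 0≤c (pos⇒nonNeg pos-𝟙)

  pos-const⁻¹ : ∀ {c} → Pos (λ θ 𝟙 → c * 𝟙) → 0ℤ < c
  pos-const⁻¹ {c} (mkPos h) with eventually-witness (eventually-zip h (Pos.eventually-pos pos-𝟙))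
  ... | k , (0<cq , 0<q) = 0<*⁻¹ 0<q (subst (0ℤ <_) (*-comm c _) 0<cq)

  below⇒pos : ∀ {m N} → Below cf m N → Pos (λ θ 𝟙 → + N * θ - + m * 𝟙)
  below⇒pos {m} {N} below = mkPos (eventually-map (λ k → 0<-of-ℕ< {m} {denom cf k} {N} {numer cf k}) below)

  above⇒pos : ∀ {m N} → Above cf m N → Pos (λ θ 𝟙 → + m * 𝟙 - + N * θ)
  above⇒pos {m} {N} above = mkPos (eventually-map (λ k → 0<-of-ℕ< {N} {numer cf k} {m} {denom cf k}) above)

  floorMul-bounds : ∀ {N} → 1 ℕ.≤ N →
    Pos (λ θ 𝟙 → + N * θ - + floorMul cf N * 𝟙) × Pos (λ θ 𝟙 → (+ floorMul cf N + 1ℤ) * 𝟙 - + N * θ)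
  floorMul-bounds {N} N≥1 with floorMul-spec icf N≥1
  ... | below , above = below⇒pos {floorMul cf N} {N} below ,
                        pos-resp (above⇒pos {ℕ.suc (floorMul cf N)} {N} above) λ θ 𝟙 →
        cong (λ x → x * 𝟙 - + N * θ) (trans (cong +_ (ℕ.+-comm 1 (floorMul cf N))) (pos-+ (floorMul cf N) 1))

  record IsFloor (f : Form) (t : ℤ) : Set where
    constructor mkFloor
    field
      floor≤ : NonNeg (λ θ 𝟙 → f θ 𝟙 - t * 𝟙)
      <floor+1 : Pos (λ θ 𝟙 → (t + 1ℤ) * 𝟙 - f θ 𝟙)

  floor-unique : ∀ {f s t} → IsFloor f s → IsFloor f t → s ≡ t
  floor-unique {f} {s} {t} (mkFloor s≤f f<s+1) (mkFloor t≤f f<t+1) =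
    ≤-antisym (floor-≤ {s} {t} s≤f f<t+1) (floor-≤ {t} {s} t≤f f<s+1)
    where
    telescope : ∀ F s t 𝟙 → (t + 1ℤ) * 𝟙 - F + (F - s * 𝟙) ≡ (t - s + 1ℤ) * 𝟙
    telescope = solve-∀
    floor-≤ : ∀ {s t} → NonNeg (λ θ 𝟙 → f θ 𝟙 - s * 𝟙) → Pos (λ θ 𝟙 → (t + 1ℤ) * 𝟙 - f θ 𝟙) → s ≤ t
    floor-≤ {s} {t} s≤f f<t+1 = 0≤i-j⇒j≤i (0≤-of-0<+1 (t - s)
      (pos-const⁻¹ (pos-resp (pos+nonNeg f<t+1 s≤f) λ θ 𝟙 → telescope (f θ 𝟙) s t 𝟙)))

  isFloor-resp : ∀ {f g t} → IsFloor f t → f ≐ g → IsFloor g t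
  isFloor-resp {f} {g} {t} (mkFloor t≤f f<t+1) f≐g = mkFloor
    (nonNeg-resp t≤f λ θ 𝟙 → cong (_- t * 𝟙) (f≐g θ 𝟙))
    (pos-resp f<t+1 λ θ 𝟙 → cong (λ x → (t + 1ℤ) * 𝟙 - x) (f≐g θ 𝟙))

  record Window (y f : Form) : Set where
    constructor mkWindow
    field
      above : Pos (λ θ 𝟙 → f θ 𝟙 - y θ 𝟙)
      below : Pos (λ θ 𝟙 → y θ 𝟙 + 𝟙 - f θ 𝟙)

  floorMul-isFloor : ∀ {N} → 1 ℕ.≤ N → IsFloor (λ θ 𝟙 → + N * θ) (+ floorMul cf N)
  floorMul-isFloor N≥1 with floorMul-bounds N≥1
  ... | lower , upper = mkFloor (pos⇒nonNeg lower) upper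

  floor-exists : ∀ x y → Σ ℤ (IsFloor (λ θ 𝟙 → x * θ + y * 𝟙))
  floor-exists +0 y = y , mkFloor
    (nonNeg-resp (nonNeg-const {0ℤ} (+≤+ z≤n)) (λ θ 𝟙 → solve (θ ∷ 𝟙 ∷ y ∷ [])))
    (pos-resp pos-𝟙 (λ θ 𝟙 → solve (θ ∷ 𝟙 ∷ y ∷ [])))
  floor-exists +[1+ n ] y =
    + floorMul cf (ℕ.suc n) + y ,
    floor-pos (+[1+ n ]) (+ floorMul cf (ℕ.suc n)) y (floorMul-bounds {ℕ.suc n} (s≤s z≤n))
    where
    floor-pos : ∀ X M y → Pos (λ θ 𝟙 → X * θ - M * 𝟙) × Pos (λ θ 𝟙 → (M + 1ℤ) * 𝟙 - X * θ) →
                IsFloor (λ θ 𝟙 → X * θ + y * 𝟙) (M + y)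
    floor-pos X M y (lower , upper) = mkFloor
      (nonNeg-resp (pos⇒nonNeg lower) (λ θ 𝟙 → solve (θ ∷ 𝟙 ∷ X ∷ M ∷ y ∷ [])))
      (pos-resp upper (λ θ 𝟙 → solve (θ ∷ 𝟙 ∷ X ∷ M ∷ y ∷ [])))
  floor-exists -[1+ n ] y =
    y - (+ floorMul cf (ℕ.suc n) + 1ℤ) ,
    floor-neg (+[1+ n ]) (+ floorMul cf (ℕ.suc n)) y (floorMul-bounds {ℕ.suc n} (s≤s z≤n))
    where
    floor-neg : ∀ X M y → Pos (λ θ 𝟙 → X * θ - M * 𝟙) × Pos (λ θ 𝟙 → (M + 1ℤ) * 𝟙 - X * θ) →
                IsFloor (λ θ 𝟙 → (- X) * θ + y * 𝟙) (y - (M + 1ℤ))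
    floor-neg X M y (lower , upper) = mkFloor
      (nonNeg-resp (pos⇒nonNeg upper) (λ θ 𝟙 → solve (θ ∷ 𝟙 ∷ X ∷ M ∷ y ∷ [])))
      (pos-resp lower (λ θ 𝟙 → solve (θ ∷ 𝟙 ∷ X ∷ M ∷ y ∷ [])))

  sign-cases : ∀ x y → Pos (λ θ 𝟙 → - (x * θ + y * 𝟙)) ⊎ NonNeg (λ θ 𝟙 → x * θ + y * 𝟙)
  sign-cases x y with floor-exists x y
  ... | + n , mkFloor t≤f _ =
    inj₂ (nonNeg-resp (nonNeg+nonNeg t≤f (nonNeg-const {+ n} (+≤+ z≤n))) λ θ 𝟙 → cancel (x * θ + y * 𝟙) (+ n) 𝟙)
    where
    cancel : ∀ F t 𝟙 → F - t * 𝟙 + t * 𝟙 ≡ F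
    cancel = solve-∀
  ... | t@(-[1+ n ]) , mkFloor _ f<t+1 =
    inj₁ (pos-resp (pos+nonNeg f<t+1 (nonNeg-const { - (1ℤ + t)} (neg-mono-≤ t+1≤0)))
      λ θ 𝟙 → cancel (x * θ + y * 𝟙) t 𝟙)
    where
    t+1≤0 : 1ℤ + t ≤ 0ℤ
    t+1≤0 = i<j⇒suc[i]≤j (-<+ {n} {0})
    cancel : ∀ F t 𝟙 → (t + 1ℤ) * 𝟙 - F + (- (1ℤ + t)) * 𝟙 ≡ - F
    cancel = solve-∀

module Gaps where

  open import Data.Nat as ℕ using (zero; suc)
  open import Data.Integer hiding (suc)
  open import Data.Integer.Properties
  open import Data.Sum using (_⊎_; inj₁; inj₂)
  open import Relation.Binary.PropositionalEquality
  open import Data.Integer.Tactic.RingSolver using (solve-∀)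
  open Convergents
  open Eventually
  open Forms using (Pos; mkPos; pos-resp; pos-𝟙; pos-𝟙-θ)

  sgn : ℕ → ℤ
  sgn zero    = -1ℤ
  sgn (suc k) = - sgn k

  sgn-unit : ∀ k → sgn k ≡ 1ℤ ⊎ sgn k ≡ -1ℤ
  sgn-unit zero = inj₂ refl
  sgn-unit (suc k) with sgn-unit k
  ... | inj₁ s≡1  = inj₂ (cong -_ s≡1)
  ... | inj₂ s≡-1 = inj₁ (cong -_ s≡-1)

  -- sgn k is the sign of denom k · θ − numer k, so that gap cf k = |denom k · θ − numer k|.
  gap : (ℕ → ℕ) → ℕ → Form
  gap cf k θ 𝟙 = sgn k * (+ denom cf k * θ - + numer cf k * 𝟙)

  private
    numer-suc-ℤ : ∀ cf k → + numer cf (suc k) ≡ + denom (shift cf) k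
    numer-suc-ℤ cf k = cong +_ (numer-suc cf k)

    denom-suc-ℤ : ∀ cf k → + denom cf (suc k) ≡ + numer (shift cf) k + + cf 0 * + denom (shift cf) k
    denom-suc-ℤ cf k = trans (cong +_ (denom-suc cf k))
      (trans (pos-+ (numer (shift cf) k) _) (cong (λ x → + numer (shift cf) k + x) (pos-* (cf 0) _)))

  det : ∀ cf k → + numer cf (suc k) * + denom cf k - + numer cf k * + denom cf (suc k) ≡ sgn k
  det cf zero    = refl
  det cf (suc k) = begin
    + numer cf (2 ℕ.+ k) * + denom cf (suc k) - + numer cf (suc k) * + denom cf (2 ℕ.+ k)
      ≡⟨ cong₂ _-_ (cong₂ _*_ (numer-suc-ℤ cf (suc k)) (denom-suc-ℤ cf k))
                   (cong₂ _*_ (numer-suc-ℤ cf k) (denom-suc-ℤ cf (suc k))) ⟩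
    Q (suc k) * (P k + a * Q k) - Q k * (P (suc k) + a * Q (suc k))
      ≡⟨ expand a (P k) (Q k) (P (suc k)) (Q (suc k)) ⟩
    - (P (suc k) * Q k - P k * Q (suc k))
      ≡⟨ cong -_ (det (shift cf) k) ⟩
    sgn (suc k) ∎
    where
    open ≡-Reasoning
    a = + cf 0
    P Q : ℕ → ℤ
    P j = + numer (shift cf) j
    Q j = + denom (shift cf) j
    expand : ∀ a P₀ Q₀ P₁ Q₁ → Q₁ * (P₀ + a * Q₀) - Q₀ * (P₁ + a * Q₁) ≡ - (P₁ * Q₀ - P₀ * Q₁)
    expand = solve-∀

  -- Homogeneous form of θ = 1 / (cf 0 + θ′), where θ′ = [0; cf 1, cf 2, …].
  pos-of-shift : ∀ {cf} (icf : IsCF cf) {f : Form} →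
    Pos (IsCF-shift icf) (λ θ 𝟙 → f 𝟙 (θ + + cf 0 * 𝟙)) → Pos icf f
  pos-of-shift {cf} icf {f} (mkPos h) = mkPos (eventually-shift (eventually-map step h))
    where
    step : ∀ k → 0ℤ < f (+ denom (shift cf) k) (+ numer (shift cf) k + + cf 0 * + denom (shift cf) k) →
           0ℤ < f (+ numer cf (suc k)) (+ denom cf (suc k))
    step k = subst (0ℤ <_) (sym (cong₂ f (numer-suc-ℤ cf k) (denom-suc-ℤ cf k)))

  gap-shift : ∀ cf k θ 𝟙 → gap cf (suc k) 𝟙 (θ + + cf 0 * 𝟙) ≡ gap (shift cf) k θ 𝟙
  gap-shift cf k θ 𝟙 = begin
    - sgn k * (+ denom cf (suc k) * 𝟙 - + numer cf (suc k) * (θ + a * 𝟙))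
      ≡⟨ cong (λ x → - sgn k * x) (cong₂ (λ u v → u * 𝟙 - v * (θ + a * 𝟙)) (denom-suc-ℤ cf k) (numer-suc-ℤ cf k)) ⟩
    - sgn k * ((P + a * Q) * 𝟙 - Q * (θ + a * 𝟙))
      ≡⟨ expand (sgn k) a P Q θ 𝟙 ⟩
    sgn k * (Q * θ - P * 𝟙) ∎
    where
    open ≡-Reasoning
    a = + cf 0
    P = + numer (shift cf) k
    Q = + denom (shift cf) k
    expand : ∀ s a P Q θ 𝟙 → - s * ((P + a * Q) * 𝟙 - Q * (θ + a * 𝟙)) ≡ s * (Q * θ - P * 𝟙)
    expand = solve-∀

  gap-pos : ∀ {cf} (icf : IsCF cf) k → Pos icf (gap cf k)
  gap-pos icf zero = pos-resp icf (pos-𝟙 icf) initial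
    where
    initial : ∀ θ 𝟙 → 𝟙 ≡ -1ℤ * (+ 0 * θ - + 1 * 𝟙)
    initial = solve-∀
  gap-pos {cf} icf (suc k) =
    pos-of-shift icf (pos-resp (IsCF-shift icf) (gap-pos (IsCF-shift icf) k) λ θ 𝟙 → sym (gap-shift cf k θ 𝟙))

  gap-decreasing : ∀ {cf} (icf : IsCF cf) k → Pos icf (λ θ 𝟙 → gap cf k θ 𝟙 - gap cf (suc k) θ 𝟙)
  gap-decreasing icf zero = pos-resp icf (pos-𝟙-θ icf) initial
    where
    initial : ∀ θ 𝟙 → 𝟙 - θ ≡ -1ℤ * (+ 0 * θ - + 1 * 𝟙) - 1ℤ * (+ 1 * θ - + 0 * 𝟙)
    initial = solve-∀
  gap-decreasing {cf} icf (suc k) =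
    pos-of-shift icf (pos-resp (IsCF-shift icf) (gap-decreasing (IsCF-shift icf) k) λ θ 𝟙 →
      sym (cong₂ _-_ (gap-shift cf k θ 𝟙) (gap-shift cf (suc k) θ 𝟙)))

module Approximation {cf : ℕ → ℕ} (icf : IsCF cf) where

  open import Data.Nat as ℕ using (suc; z≤n; z<s)
  open import Data.Integer hiding (suc)
  open import Data.Integer.Properties
  open import Data.Product using (_×_; _,_)
  open import Data.Sum using (_⊎_; inj₁; inj₂)
  open import Data.Empty using (⊥-elim)
  open import Relation.Nullary using (¬_)
  open import Relation.Binary.PropositionalEquality
  open import Data.Integer.Tactic.RingSolver using (solve-∀)
  open Convergents
  open Sign
  open Forms icf
  open Gaps

  sq-unit : ∀ {s} → s ≡ 1ℤ ⊎ s ≡ -1ℤ → s * s ≡ 1ℤ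
  sq-unit (inj₁ refl) = refl
  sq-unit (inj₂ refl) = refl

  -- p/q and p′/q′ are consecutive convergents of θ, and s = ±1 is the sign of q θ − p.
  record Consecutive (p q p′ q′ s : ℤ) : Set where
    field
      determinant : p′ * q - p * q′ ≡ s
      sign-unit   : s ≡ 1ℤ ⊎ s ≡ -1ℤ
      gap>0       : Pos (λ θ 𝟙 → s * (q * θ - p * 𝟙))
      gap′>0      : Pos (λ θ 𝟙 → (- s) * (q′ * θ - p′ * 𝟙))

    det-cancel : ∀ x → s * (p′ * q - p * q′) * x ≡ x
    det-cancel x = trans (cong (λ y → s * y * x) determinant) (trans (cong (_* x) (sq-unit sign-unit)) (*-identityˡ x))

    gaps-weighted-sum : ∀ θ 𝟙 → q′ * (s * (q * θ - p * 𝟙)) + q * ((- s) * (q′ * θ - p′ * 𝟙)) ≡ 𝟙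
    gaps-weighted-sum θ 𝟙 = trans (expand s p q p′ q′ θ 𝟙) (det-cancel 𝟙)
      where
      expand : ∀ s p q p′ q′ θ 𝟙 →
        q′ * (s * (q * θ - p * 𝟙)) + q * ((- s) * (q′ * θ - p′ * 𝟙)) ≡ s * (p′ * q - p * q′) * 𝟙
      expand = solve-∀

    bezout : (- s * q′) * p + (s * p′) * q ≡ 1ℤ
    bezout = trans (expand s p q p′ q′) (det-cancel 1ℤ)
      where
      expand : ∀ s p q p′ q′ → (- s * q′) * p + (s * p′) * q ≡ s * (p′ * q - p * q′) * 1ℤ
      expand = solve-∀

  consecutive : ∀ k → Consecutive (+ numer cf k) (+ denom cf k) (+ numer cf (suc k)) (+ denom cf (suc k)) (sgn k)
  consecutive k = record
    { determinant = det cf k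
    ; sign-unit   = sgn-unit k
    ; gap>0       = gap-pos icf k
    ; gap′>0      = gap-pos icf (suc k)
    }

  private
    exceeds : ∀ {a b d} α β → 0ℤ < a → a ≤ d → d < b → 0ℤ ≤ α → 0ℤ < β → d < α * a + β * b
    exceeds {a} {b} {d} α β 0<a a≤d d<b 0≤α 0<β = begin-strict
      d              <⟨ d<b ⟩
      b              ≡⟨ *-identityˡ b ⟨
      1ℤ * b         ≤⟨ *-monoʳ-≤-nonNeg b ⦃ nonNegative 0≤b ⦄ (i<j⇒suc[i]≤j 0<β) ⟩
      β * b          ≤⟨ i≤j+i (β * b) (α * a) ⦃ nonNegative (0≤* 0≤α (<⇒≤ 0<a)) ⦄ ⟩
      α * a + β * b  ∎
      where
      open ≤-Reasoning
      0≤b = <⇒≤ (<-trans (<-≤-trans 0<a a≤d) d<b)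

    not-±d : ∀ {d v} → 0ℤ < d → d < v → ¬ (v ≡ d ⊎ v ≡ - d)
    not-±d 0<d d<v (inj₁ refl) = <-irrefl refl d<v
    not-±d 0<d d<v (inj₂ refl) = <-irrefl refl (<-trans d<v (<-trans (neg-mono-< 0<d) 0<d))

    both-nonPos : ∀ {a b d} α β → 0ℤ < a → a ≤ d → d < b → α ≤ 0ℤ → β < 0ℤ →
                  ¬ (α * a + β * b ≡ d ⊎ α * a + β * b ≡ - d)
    both-nonPos {a} {b} {d} α β 0<a a≤d d<b α≤0 β<0 v≡±d =
      not-±d (<-≤-trans 0<a a≤d) (subst (d <_) (negate α β a b) (exceeds (- α) (- β) 0<a a≤d d<b (neg-mono-≤ α≤0) (neg-mono-< β<0)))
        (flip v≡±d)
      where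
      negate : ∀ α β a b → - α * a + - β * b ≡ - (α * a + β * b)
      negate = solve-∀
      flip : α * a + β * b ≡ d ⊎ α * a + β * b ≡ - d → - (α * a + β * b) ≡ d ⊎ - (α * a + β * b) ≡ - d
      flip (inj₁ v≡d)  = inj₂ (cong -_ v≡d)
      flip (inj₂ v≡-d) = inj₁ (trans (cong -_ v≡-d) (neg-involutive d))

  opposite-signs : ∀ {a b d} α β → 0ℤ < a → a ≤ d → d < b → (α * a + β * b ≡ d ⊎ α * a + β * b ≡ - d) →
                   (0ℤ < α × β ≤ 0ℤ) ⊎ (α < 0ℤ × 0ℤ ≤ β)
  opposite-signs +[1+ m ] +0       _ _ _ _ = inj₁ (+<+ z<s , ≤-refl)
  opposite-signs +[1+ m ] -[1+ n ] _ _ _ _ = inj₁ (+<+ z<s , -≤+)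
  opposite-signs -[1+ m ] (+ n)    _ _ _ _ = inj₂ (-<+ , +≤+ z≤n)
  opposite-signs {a} {b} {d} (+ m) +[1+ n ] 0<a a≤d d<b v≡±d =
    ⊥-elim (not-±d (<-≤-trans 0<a a≤d) (exceeds (+ m) +[1+ n ] 0<a a≤d d<b (+≤+ z≤n) (+<+ z<s)) v≡±d)
  opposite-signs +0 +0 0<a a≤d _ (inj₁ 0≡d) = ⊥-elim (<-irrefl 0≡d (<-≤-trans 0<a a≤d))
  opposite-signs {d = d} +0 +0 0<a a≤d _ (inj₂ 0≡-d) =
    ⊥-elim (<-irrefl (trans (cong -_ 0≡-d) (neg-involutive d)) (<-≤-trans 0<a a≤d))
  opposite-signs α@(+0) β@(-[1+ n ]) 0<a a≤d d<b v≡±d = ⊥-elim (both-nonPos α β 0<a a≤d d<b (+≤+ z≤n) -<+ v≡±d)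
  opposite-signs α@(-[1+ m ]) β@(-[1+ n ]) 0<a a≤d d<b v≡±d = ⊥-elim (both-nonPos α β 0<a a≤d d<b -≤+ -<+ v≡±d)

  private
    basis-change : ∀ p q p′ q′ d e → (p′ * d - q′ * e) * q + (q * e - p * d) * q′ ≡ (p′ * q - p * q′) * d
    basis-change = solve-∀

  module _ {p q p′ q′ s : ℤ} (c : Consecutive p q p′ q′ s) where

    open Consecutive c

    expansion : ∀ d e θ 𝟙 →
      (p′ * d - q′ * e) * (s * (q * θ - p * 𝟙)) + (- (q * e - p * d)) * ((- s) * (q′ * θ - p′ * 𝟙)) ≡ d * θ - e * 𝟙
    expansion d e θ 𝟙 = trans (expand s p q p′ q′ d e θ 𝟙) (det-cancel (d * θ - e * 𝟙))
      where
      expand : ∀ s p q p′ q′ d e θ 𝟙 →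
        (p′ * d - q′ * e) * (s * (q * θ - p * 𝟙)) + (- (q * e - p * d)) * ((- s) * (q′ * θ - p′ * 𝟙))
          ≡ s * (p′ * q - p * q′) * (d * θ - e * 𝟙)
      expand = solve-∀

    private
      combination : ∀ d e → (p′ * d - q′ * e) * q + (q * e - p * d) * q′ ≡ s * d
      combination d e = trans (basis-change p q p′ q′ d e) (cong (_* d) determinant)

    expansion-at-q : ∀ d e → let v = (p′ * d - q′ * e) * q + (q * e - p * d) * q′ in v ≡ d ⊎ v ≡ - d
    expansion-at-q d e with sign-unit
    ... | inj₁ s≡1  = inj₁ (trans (combination d e) (trans (cong (_* d) s≡1) (*-identityˡ d)))
    ... | inj₂ s≡-1 = inj₂ (trans (combination d e) (trans (cong (_* d) s≡-1) (-1*i≡-i d)))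

    -- (B + 2) q A > 1 for the gap A = |q θ − p|, since q′ A + q A′ = 1, A > A′ and q′ ≤ (B + 1) q.
    scaled-gap : ∀ {B} → 0ℤ < q → Pos (λ θ 𝟙 → s * (q * θ - p * 𝟙) - (- s) * (q′ * θ - p′ * 𝟙)) →
      q′ ≤ (B + 1ℤ) * q → Pos (λ θ 𝟙 → (B + + 2) * q * (s * (q * θ - p * 𝟙)) - 𝟙)
    scaled-gap {B} 0<q A>A′ q′≤[B+1]q =
      pos-resp (pos+nonNeg (pos-scale 0<q A>A′) (nonNeg-scale (i≤j⇒0≤j-i q′≤[B+1]q) (pos⇒nonNeg gap>0)))
      λ θ 𝟙 → let A = s * (q * θ - p * 𝟙) ; A′ = (- s) * (q′ * θ - p′ * 𝟙) in begin
        q * (A - A′) + ((B + 1ℤ) * q - q′) * A    ≡⟨ regroup q q′ B A A′ ⟩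
        (B + + 2) * q * A - (q′ * A + q * A′)     ≡⟨ cong (λ z → (B + + 2) * q * A - z) (gaps-weighted-sum θ 𝟙) ⟩
        (B + + 2) * q * A - 𝟙                     ∎
      where
      open ≡-Reasoning
      regroup : ∀ q q′ B a a′ → q * (a - a′) + ((B + 1ℤ) * q - q′) * a ≡ (B + + 2) * q * a - (q′ * a + q * a′)
      regroup = solve-∀

    beyond-gap : ∀ {X D} {g : Form} → 0ℤ ≤ X → X ≤ D → Pos (λ θ 𝟙 → X * (s * (q * θ - p * 𝟙)) - 𝟙) →
      NonNeg (λ θ 𝟙 → g θ 𝟙 - s * (q * θ - p * 𝟙)) → Pos (λ θ 𝟙 → D * g θ 𝟙 - 𝟙)
    beyond-gap {X} {D} {g} 0≤X X≤D XA>1 g≥A = pos-resp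
      (pos+nonNeg XA>1 (nonNeg+nonNeg (nonNeg-scale 0≤X g≥A) (nonNeg-scale (i≤j⇒0≤j-i X≤D) g≥0)))
      λ θ 𝟙 → split X D (s * (q * θ - p * 𝟙)) (g θ 𝟙) 𝟙
      where
      cancel : ∀ G a → G - a + a ≡ G
      cancel = solve-∀
      g≥0 : NonNeg g
      g≥0 = nonNeg-resp (nonNeg+nonNeg g≥A (pos⇒nonNeg gap>0)) λ θ 𝟙 → cancel (g θ 𝟙) (s * (q * θ - p * 𝟙))
      split : ∀ X D a G 𝟙 → X * a - 𝟙 + (X * (G - a) + (D - X) * G) ≡ D * G - 𝟙
      split = solve-∀

    -- Writing (d, e) in the basis (q, p), (q′, p′), the coefficients have opposite signs, so
    -- |d θ − e| is at least the gap |q θ − p|.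
    approximation-bound : Pos (λ θ 𝟙 → s * (q * θ - p * 𝟙) - (- s) * (q′ * θ - p′ * 𝟙)) →
      ∀ {B d D} → 0ℤ ≤ B → 0ℤ < q → q ≤ d → d < q′ → q′ ≤ (B + 1ℤ) * q → (B + + 2) * q ≤ D → ∀ e →
      Pos (λ θ 𝟙 → D * (d * θ - e * 𝟙) - 𝟙) ⊎ Pos (λ θ 𝟙 → D * (e * 𝟙 - d * θ) - 𝟙)
    approximation-bound A>A′ {B} {d} {D} 0≤B 0<q q≤d d<q′ q′≤[B+1]q X≤D e =
      conclude (opposite-signs α β 0<q q≤d d<q′ (expansion-at-q d e))
      where
      α = p′ * d - q′ * e
      β = q * e - p * d
      beyond : ∀ {g : Form} → NonNeg (λ θ 𝟙 → g θ 𝟙 - s * (q * θ - p * 𝟙)) → Pos (λ θ 𝟙 → D * g θ 𝟙 - 𝟙)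
      beyond = beyond-gap (0≤* (+-mono-≤ 0≤B (+≤+ z≤n)) (<⇒≤ 0<q)) X≤D (scaled-gap {B} 0<q A>A′ q′≤[B+1]q)
      peel : ∀ x y a a′ → (x - 1ℤ) * a + y * a′ ≡ x * a + y * a′ - a
      peel = solve-∀
      negate : ∀ α β a a′ d e θ 𝟙 → α * a + (- β) * a′ ≡ d * θ - e * 𝟙 → - α * a + β * a′ ≡ e * 𝟙 - d * θ
      negate α β a a′ d e θ 𝟙 eq = trans (flip α β a a′) (trans (cong -_ eq) (flip′ d e θ 𝟙))
        where
        flip : ∀ α β a a′ → - α * a + β * a′ ≡ - (α * a + (- β) * a′)
        flip = solve-∀
        flip′ : ∀ d e θ 𝟙 → - (d * θ - e * 𝟙) ≡ e * 𝟙 - d * θ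
        flip′ = solve-∀
      conclude : (0ℤ < α × β ≤ 0ℤ) ⊎ (α < 0ℤ × 0ℤ ≤ β) →
                 Pos (λ θ 𝟙 → D * (d * θ - e * 𝟙) - 𝟙) ⊎ Pos (λ θ 𝟙 → D * (e * 𝟙 - d * θ) - 𝟙)
      conclude (inj₁ (0<α , β≤0)) = inj₁ (beyond (nonNeg-resp
        (nonNeg+nonNeg (nonNeg-scale (i≤j⇒0≤j-i (i<j⇒suc[i]≤j 0<α)) (pos⇒nonNeg gap>0))
                       (nonNeg-scale (neg-mono-≤ β≤0) (pos⇒nonNeg gap′>0)))
        λ θ 𝟙 → let A = s * (q * θ - p * 𝟙) ; A′ = (- s) * (q′ * θ - p′ * 𝟙) in
          trans (peel α (- β) A A′) (cong (_- A) (expansion d e θ 𝟙))))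
      conclude (inj₂ (α<0 , 0≤β)) = inj₂ (beyond (nonNeg-resp
        (nonNeg+nonNeg (nonNeg-scale (i≤j⇒0≤j-i (i<j⇒suc[i]≤j (neg-mono-< α<0))) (pos⇒nonNeg gap>0))
                       (nonNeg-scale 0≤β (pos⇒nonNeg gap′>0)))
        λ θ 𝟙 → let A = s * (q * θ - p * 𝟙) ; A′ = (- s) * (q′ * θ - p′ * 𝟙) in
          trans (peel (- α) β A A′) (cong (_- A) (negate α β A A′ d e θ 𝟙 (expansion d e θ 𝟙)))))

  approximation : ∀ B → BoundedPQ B cf → ∀ {d} → 1 ℕ.≤ d → ∀ {D} → (+ B + + 2) * + d ≤ D → ∀ e →
    Pos (λ θ 𝟙 → D * (+ d * θ - e * 𝟙) - 𝟙) ⊎ Pos (λ θ 𝟙 → D * (e * 𝟙 - + d * θ) - 𝟙)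
  approximation B bnd {d} d≥1 {D} X≤D e with denom-bracket icf d≥1
  ... | j , q≤d , d<q′ = approximation-bound (consecutive (suc j)) (gap-decreasing icf (suc j))
        {+ B} {+ d} {D} (+≤+ z≤n) (+<+ (denom-pos icf j)) (+≤+ q≤d) (+<+ d<q′) q′≤[B+1]q
        (≤-trans (*-monoˡ-≤-nonNeg (+ B + + 2) (+≤+ q≤d)) X≤D) e
    where
    q = denom cf (1 ℕ.+ j)
    q′≤[B+1]q : + denom cf (2 ℕ.+ j) ≤ (+ B + 1ℤ) * + q
    q′≤[B+1]q = subst (+ denom cf (2 ℕ.+ j) ≤_) (trans (pos-* (B ℕ.+ 1) q) (cong (_* + q) (pos-+ B 1)))
                  (+≤+ (denom-bounded icf B bnd j))

module Density {cf : ℕ → ℕ} (icf : IsCF cf) where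

  open import Data.Nat as ℕ using (z≤n)
  open import Data.Integer hiding (suc)
  open import Data.Integer.Properties
  open import Data.Integer.DivMod using (n%ℕd<d; a≡a%ℕn+[a/ℕn]*n)
  open import Data.Product using (Σ; _×_; _,_; proj₁; proj₂)
  open import Data.Sum using (_⊎_; inj₁; inj₂)
  open import Relation.Binary.PropositionalEquality
  open import Data.Integer.Tactic.RingSolver using (solve-∀)
  open Sign
  open Forms icf
  open Approximation icf using (Consecutive; module Consecutive; sq-unit)

  multiple-in-interval : ∀ f (M : ℕ) .{{_ : ℕ.NonZero M}} → Σ ℤ λ t → f < + M * t × + M * t ≤ f + + M
  multiple-in-interval f M = h + 1ℤ , f<Mt , Mt≤f+M
    where
    open ≤-Reasoning
    r = f %ℕ M
    h = f /ℕ M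
    f≡ : f ≡ + r + h * + M
    f≡ = a≡a%ℕn+[a/ℕn]*n f M
    distrib : ∀ M h → M + h * M ≡ M * (h + 1ℤ)
    distrib = solve-∀
    f<Mt : f < + M * (h + 1ℤ)
    f<Mt = begin-strict
      f              ≡⟨ f≡ ⟩
      + r + h * + M  <⟨ +-monoˡ-< (h * + M) (+<+ (n%ℕd<d f M)) ⟩
      + M + h * + M  ≡⟨ distrib (+ M) h ⟩
      + M * (h + 1ℤ) ∎
    Mt≤f+M : + M * (h + 1ℤ) ≤ f + + M
    Mt≤f+M = begin
      + M * (h + 1ℤ)       ≡⟨ trans (+-comm (h * + M) (+ M)) (distrib (+ M) h) ⟨
      h * + M + + M        ≤⟨ +-monoˡ-≤ (+ M) (i≤j+i (h * + M) (+ r)) ⟩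
      + r + h * + M + + M  ≡⟨ cong (_+ + M) f≡ ⟨
      f + + M              ∎

  residue : ∀ (q : ℕ) .{{_ : ℕ.NonZero q}} {p u v : ℤ} → u * p + v * + q ≡ 1ℤ →
            ∀ t → Σ ℕ λ i → i ℕ.< q × Σ ℤ λ j → + i * p ≡ t + + q * j
  residue q {p} {u} {v} bezout t = i , n%ℕd<d w q , j , i-j≡0⇒i≡j _ _ (begin
    + i * p - (t + + q * j)
      ≡⟨ expand (+ i) p t (+ q) h u v ⟩
    (+ i + h * + q - w) * p + t * (u * p + v * + q - 1ℤ)
      ≡⟨ cong₂ (λ x y → x * p + t * y) (trans (cong (_- w) (sym w≡)) (+-inverseʳ w))
                                       (trans (cong (_- 1ℤ) bezout) (+-inverseʳ 1ℤ)) ⟩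
    0ℤ * p + t * 0ℤ
      ≡⟨ cong (λ x → 0ℤ + x) (*-zeroʳ t) ⟩
    0ℤ ∎)
    where
    open ≡-Reasoning
    w = t * u
    i = w %ℕ q
    h = w /ℕ q
    j = - (t * v) - h * p
    w≡ : w ≡ + i + h * + q
    w≡ = a≡a%ℕn+[a/ℕn]*n w q
    expand : ∀ i p t q h u v →
      i * p - (t + q * (- (t * v) - h * p)) ≡ (i + h * q - t * u) * p + t * (u * p + v * q - 1ℤ)
    expand = solve-∀

  private
    spread-bounds : ∀ {q i s} → 0ℤ ≤ i → i < q → s ≡ 1ℤ ⊎ s ≡ -1ℤ → 0ℤ ≤ q + i * s × 0ℤ ≤ q - i * s
    spread-bounds {q} {i} 0≤i i<q (inj₁ refl) =
      subst (λ z → 0ℤ ≤ q + z) (sym (*-identityʳ i)) (+-mono-≤ (≤-trans 0≤i (<⇒≤ i<q)) 0≤i) ,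
      subst (λ z → 0ℤ ≤ q - z) (sym (*-identityʳ i)) (i≤j⇒0≤j-i (<⇒≤ i<q))
    spread-bounds {q} {i} 0≤i i<q (inj₂ refl) =
      subst (λ z → 0ℤ ≤ q + z) (sym i*-1≡-i) (i≤j⇒0≤j-i (<⇒≤ i<q)) ,
      subst (λ z → 0ℤ ≤ q - z) (sym i*-1≡-i)
        (subst (λ z → 0ℤ ≤ q + z) (sym (neg-involutive i)) (+-mono-≤ (≤-trans 0≤i (<⇒≤ i<q)) 0≤i))
      where
      i*-1≡-i : i * -1ℤ ≡ - i
      i*-1≡-i = trans (*-comm i -1ℤ) (-1*i≡-i i)

  module _ {p q p′ q′ s : ℤ} (c : Consecutive p q p′ q′ s) where

    open Consecutive c

    residue-identity : ∀ {M t i j} → i * p ≡ t + q * j → ∀ Y θ 𝟙 →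
      q * (M * (i * θ - j * 𝟙) - Y) ≡
      (M * t * 𝟙 - (q * Y + M * q * (s * (q * θ - p * 𝟙)))) + M * (q + i * s) * (s * (q * θ - p * 𝟙))
    residue-identity {M} {t} {i} {j} ip≡t+qj Y θ 𝟙 = begin
      q * (M * (i * θ - j * 𝟙) - Y)
        ≡⟨ expand M i θ j 𝟙 Y q t s p ⟩
      E + M * i * (1ℤ - s * s) * (q * θ - p * 𝟙) + M * 𝟙 * (i * p - (t + q * j))
        ≡⟨ cong₂ (λ u v → E + M * i * u * (q * θ - p * 𝟙) + M * 𝟙 * v)
                 (i≡j⇒i-j≡0 (sym (sq-unit sign-unit))) (i≡j⇒i-j≡0 ip≡t+qj) ⟩
      E + M * i * 0ℤ * (q * θ - p * 𝟙) + M * 𝟙 * 0ℤ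
        ≡⟨ drop E (M * i) (q * θ - p * 𝟙) (M * 𝟙) ⟩
      E ∎
      where
      open ≡-Reasoning
      E = (M * t * 𝟙 - (q * Y + M * q * (s * (q * θ - p * 𝟙)))) + M * (q + i * s) * (s * (q * θ - p * 𝟙))
      expand : ∀ M i θ j 𝟙 Y q t s p → q * (M * (i * θ - j * 𝟙) - Y) ≡
        (M * t * 𝟙 - (q * Y + M * q * (s * (q * θ - p * 𝟙)))) + M * (q + i * s) * (s * (q * θ - p * 𝟙))
          + M * i * (1ℤ - s * s) * (q * θ - p * 𝟙) + M * 𝟙 * (i * p - (t + q * j))
      expand = solve-∀
      drop : ∀ E u v w → E + u * 0ℤ * v + w * 0ℤ ≡ E
      drop = solve-∀

    -- The grid spacing M / q plus twice the error M |q θ − p| stays below 1.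
    margin : ∀ {M} → 0ℤ < q → 0ℤ < q′ → 0ℤ < M → M * q′ + + 2 * M * q ≤ q * q′ →
      Pos (λ θ 𝟙 → q * 𝟙 - M * 𝟙 - + 2 * M * q * (s * (q * θ - p * 𝟙)))
    margin {M} 0<q 0<q′ 0<M spacing = pos-unscale 0<q′ (pos-resp
      (pos+nonNeg (pos-scale (0<* (0<* (0<* 0<2 0<M) 0<q) 0<q) gap′>0) (nonNeg-const (i≤j⇒0≤j-i spacing)))
      λ θ 𝟙 → let A = s * (q * θ - p * 𝟙) ; A′ = (- s) * (q′ * θ - p′ * 𝟙) in begin
        + 2 * M * q * q * A′ + (q * q′ - (M * q′ + + 2 * M * q)) * 𝟙
          ≡⟨ expand M q q′ A A′ 𝟙 ⟩
        q′ * (q * 𝟙 - M * 𝟙 - + 2 * M * q * A) + + 2 * M * q * (q′ * A + q * A′ - 𝟙)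
          ≡⟨ cong (λ z → q′ * (q * 𝟙 - M * 𝟙 - + 2 * M * q * A) + + 2 * M * q * z) (i≡j⇒i-j≡0 (gaps-weighted-sum θ 𝟙)) ⟩
        q′ * (q * 𝟙 - M * 𝟙 - + 2 * M * q * A) + + 2 * M * q * 0ℤ
          ≡⟨ drop _ (+ 2 * M * q) ⟩
        q′ * (q * 𝟙 - M * 𝟙 - + 2 * M * q * A) ∎)
      where
      open ≡-Reasoning
      0<2 : 0ℤ < + 2
      0<2 = +<+ (ℕ.s≤s z≤n)
      expand : ∀ M q q′ a a′ 𝟙 → + 2 * M * q * q * a′ + (q * q′ - (M * q′ + + 2 * M * q)) * 𝟙 ≡
                                 q′ * (q * 𝟙 - M * 𝟙 - + 2 * M * q * a) + + 2 * M * q * (q′ * a + q * a′ - 𝟙)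
      expand = solve-∀
      drop : ∀ E u → E + u * 0ℤ ≡ E
      drop = solve-∀

    -- As i p ≡ t (mod q), i θ lies within |q θ − p| of t / q modulo 1; the multiple M t of M
    -- was chosen just above the floor of W = q y + M q |q θ − p|.
    window-of-residue : 0ℤ < q′ → ∀ {M} → 0ℤ < M → M * q′ + + 2 * M * q ≤ q * q′ →
      ∀ {y W : Form} → W ≐ (λ θ 𝟙 → q * y θ 𝟙 + M * q * (s * (q * θ - p * 𝟙))) →
      ∀ {f t i j} → IsFloor W f → f < M * t → M * t ≤ f + M → 0ℤ ≤ i → i < q → i * p ≡ t + q * j →
      Window y (λ θ 𝟙 → M * (i * θ - j * 𝟙))
    window-of-residue 0<q′ {M} 0<M spacing {y} {W} W≐ {f} {t} {i} {j} (mkFloor f≤W W<f+1) f<Mt Mt≤f+M 0≤i i<q ip≡t+qj =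
      mkWindow (pos-unscale 0<q (pos-resp lower λ θ 𝟙 → sym (key θ 𝟙)))
               (pos-unscale 0<q (pos-resp upper λ θ 𝟙 → sym (upper-≡ θ 𝟙)))
      where
      0<q = ≤-<-trans 0≤i i<q
      q±is≥0 = spread-bounds 0≤i i<q sign-unit
      A : Form
      A θ 𝟙 = s * (q * θ - p * 𝟙)

      key : ∀ θ 𝟙 → q * (M * (i * θ - j * 𝟙) - y θ 𝟙) ≡ (M * t * 𝟙 - W θ 𝟙) + M * (q + i * s) * A θ 𝟙
      key θ 𝟙 = trans (residue-identity {M} {t} {i} {j} ip≡t+qj (y θ 𝟙) θ 𝟙)
                      (cong (λ w → M * t * 𝟙 - w + M * (q + i * s) * A θ 𝟙) (sym (W≐ θ 𝟙)))

      lower : Pos (λ θ 𝟙 → (M * t * 𝟙 - W θ 𝟙) + M * (q + i * s) * A θ 𝟙)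
      lower = pos+nonNeg
        (pos-resp (pos+nonNeg W<f+1 (nonNeg-const (i≤j⇒0≤j-i (i<j⇒suc[i]≤j f<Mt)))) λ θ 𝟙 → cancel f (W θ 𝟙) 𝟙 (M * t))
        (nonNeg-scale (0≤* (<⇒≤ 0<M) (proj₁ q±is≥0)) (pos⇒nonNeg gap>0))
        where
        cancel : ∀ f W 𝟙 Mt → (f + 1ℤ) * 𝟙 - W + (Mt - (1ℤ + f)) * 𝟙 ≡ Mt * 𝟙 - W
        cancel = solve-∀

      upper : Pos (λ θ 𝟙 → (q * 𝟙 - M * 𝟙 - + 2 * M * q * A θ 𝟙) +
                           ((W θ 𝟙 - f * 𝟙) + ((f + M - M * t) * 𝟙 + M * (q - i * s) * A θ 𝟙)))
      upper = pos+nonNeg (margin 0<q 0<q′ 0<M spacing)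
        (nonNeg+nonNeg f≤W (nonNeg+nonNeg (nonNeg-const (i≤j⇒0≤j-i Mt≤f+M))
                                          (nonNeg-scale (0≤* (<⇒≤ 0<M) (proj₂ q±is≥0)) (pos⇒nonNeg gap>0))))

      upper-≡ : ∀ θ 𝟙 → q * (y θ 𝟙 + 𝟙 - M * (i * θ - j * 𝟙)) ≡
        (q * 𝟙 - M * 𝟙 - + 2 * M * q * A θ 𝟙) + ((W θ 𝟙 - f * 𝟙) + ((f + M - M * t) * 𝟙 + M * (q - i * s) * A θ 𝟙))
      upper-≡ θ 𝟙 = begin
        q * (y θ 𝟙 + 𝟙 - M * (i * θ - j * 𝟙))                      ≡⟨ flip q (y θ 𝟙) 𝟙 (M * (i * θ - j * 𝟙)) ⟩
        q * 𝟙 - q * (M * (i * θ - j * 𝟙) - y θ 𝟙)                  ≡⟨ cong (λ z → q * 𝟙 - z) (key θ 𝟙) ⟩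
        q * 𝟙 - ((M * t * 𝟙 - W θ 𝟙) + M * (q + i * s) * A θ 𝟙)    ≡⟨ rearrange q 𝟙 M t (W θ 𝟙) i s (A θ 𝟙) f ⟩
        (q * 𝟙 - M * 𝟙 - + 2 * M * q * A θ 𝟙) + ((W θ 𝟙 - f * 𝟙) + ((f + M - M * t) * 𝟙 + M * (q - i * s) * A θ 𝟙)) ∎
        where
        open ≡-Reasoning
        flip : ∀ q Y 𝟙 X → q * (Y + 𝟙 - X) ≡ q * 𝟙 - q * (X - Y)
        flip = solve-∀
        rearrange : ∀ q 𝟙 M t W i s a f → q * 𝟙 - ((M * t * 𝟙 - W) + M * (q + i * s) * a) ≡
          (q * 𝟙 - M * 𝟙 - + 2 * M * q * a) + ((W - f * 𝟙) + ((f + M - M * t) * 𝟙 + M * (q - i * s) * a))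
        rearrange = solve-∀

  density : ∀ {p p′ s} {q q′ : ℕ} .{{_ : ℕ.NonZero q}} .{{_ : ℕ.NonZero q′}} → Consecutive p (+ q) p′ (+ q′) s →
    ∀ (M : ℕ) .{{_ : ℕ.NonZero M}} → M ℕ.* q′ ℕ.+ 2 ℕ.* M ℕ.* q ℕ.≤ q ℕ.* q′ → ∀ y₁ y₂ →
    Σ ℕ λ i → i ℕ.< q × Σ ℤ λ j → Window (λ θ 𝟙 → y₁ * θ + y₂ * 𝟙) (λ θ 𝟙 → + M * (+ i * θ - j * 𝟙))
  density {p} {p′} {s} {q} {q′} c M spacing y₁ y₂
    with floor-exists (+ q * y₁ + + M * + q * s * + q) (+ q * y₂ - + M * + q * s * p)
  ... | f , W-floor with multiple-in-interval f M
  ...   | t , f<Mt , Mt≤f+M with residue q {p} { - s * + q′} {s * p′} (Consecutive.bezout c) t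
  ...     | i , i<q , j , ip≡t+qj = i , i<q , j ,
    window-of-residue c (+<+ (ℕ.>-nonZero⁻¹ q′)) (+<+ (ℕ.>-nonZero⁻¹ M)) spacingℤ
                      (λ θ 𝟙 → regroup (+ q) y₁ y₂ (+ M) s p θ 𝟙) W-floor f<Mt Mt≤f+M (+≤+ z≤n) (+<+ i<q) ip≡t+qj
    where
    spacingℤ : + M * + q′ + + 2 * + M * + q ≤ + q * + q′
    spacingℤ = subst₂ _≤_
      (trans (pos-+ (M ℕ.* q′) _) (cong₂ _+_ (pos-* M q′) (trans (pos-* (2 ℕ.* M) q) (cong (_* + q) (pos-* 2 M)))))
      (pos-* q q′) (+≤+ spacing)
    regroup : ∀ q y₁ y₂ M s p θ 𝟙 → (q * y₁ + M * q * s * q) * θ + (q * y₂ - M * q * s * p) * 𝟙 ≡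
                                     q * (y₁ * θ + y₂ * 𝟙) + M * q * (s * (q * θ - p * 𝟙))
    regroup = solve-∀

module SturmValues {cf : ℕ → ℕ} (icf : IsCF cf) where

  open import Data.Nat as ℕ using (_∸_; z≤n; s≤s)
  import Data.Nat.Properties as ℕ
  open import Data.Integer hiding (suc)
  open import Data.Integer.Properties
  open import Data.Product using (Σ; _,_)
  open import Data.Sum using (inj₁; inj₂)
  open import Data.List using (_∷_; [])
  open import Relation.Binary.PropositionalEquality
  open import Data.Integer.Tactic.RingSolver using (solve; solve-∀)
  open Forms icf

  private
    1≤+ : ∀ n k → 1 ℕ.≤ n ℕ.+ ℕ.suc k
    1≤+ n k = subst (1 ℕ.≤_) (ℕ.+-comm (ℕ.suc k) n) (s≤s z≤n)

  sturm-≡ : ∀ n {N m} s → N ≡ + (n ℕ.+ 1) →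
    IsFloor (λ θ 𝟙 → N * θ) m → IsFloor (λ θ 𝟙 → (N + 1ℤ) * θ) (m + + s) → sturm cf n ≡ s
  sturm-≡ n {m = m} s refl ⌊Nθ⌋ ⌊[N+1]θ⌋ = begin
    floorMul cf (n ℕ.+ 2) ∸ floorMul cf (n ℕ.+ 1)              ≡⟨ cong (_∸ floorMul cf (n ℕ.+ 1)) F₂≡F₁+s ⟩
    (floorMul cf (n ℕ.+ 1) ℕ.+ s) ∸ floorMul cf (n ℕ.+ 1)      ≡⟨ ℕ.m+n∸m≡n (floorMul cf (n ℕ.+ 1)) s ⟩
    s                                                          ∎
    where
    open ≡-Reasoning
    F₁≡m : + floorMul cf (n ℕ.+ 1) ≡ m
    F₁≡m = floor-unique (floorMul-isFloor (1≤+ n 0)) ⌊Nθ⌋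
    n+2≡ : + (n ℕ.+ 2) ≡ + (n ℕ.+ 1) + 1ℤ
    n+2≡ = trans (cong +_ (sym (ℕ.+-assoc n 1 1))) (pos-+ (n ℕ.+ 1) 1)
    F₂≡F₁+s : floorMul cf (n ℕ.+ 2) ≡ floorMul cf (n ℕ.+ 1) ℕ.+ s
    F₂≡F₁+s = +-injective (begin
      + floorMul cf (n ℕ.+ 2)       ≡⟨ floor-unique (isFloor-resp (floorMul-isFloor (1≤+ n 1)) λ θ 𝟙 → cong (_* θ) n+2≡) ⌊[N+1]θ⌋ ⟩
      m + + s                       ≡⟨ cong (_+ + s) F₁≡m ⟨
      + floorMul cf (n ℕ.+ 1) + + s ≡⟨ pos-+ (floorMul cf (n ℕ.+ 1)) s ⟨
      + (floorMul cf (n ℕ.+ 1) ℕ.+ s) ∎)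

  sturm-one : ∀ n {N m} → N ≡ + (n ℕ.+ 1) → IsFloor (λ θ 𝟙 → N * θ) m →
    NonNeg (λ θ 𝟙 → N * θ - m * 𝟙 + θ - 𝟙) → sturm cf n ≡ 1
  sturm-one n {N} {m} N≡ ⌊Nθ⌋ carry = sturm-≡ n 1 N≡ ⌊Nθ⌋ (mkFloor
    (nonNeg-resp carry λ θ 𝟙 → step₁ N m θ 𝟙)
    (pos-resp (pos+nonNeg (IsFloor.<floor+1 ⌊Nθ⌋) (pos⇒nonNeg pos-𝟙-θ)) λ θ 𝟙 → step₂ N m θ 𝟙))
    where
    step₁ : ∀ N m θ 𝟙 → N * θ - m * 𝟙 + θ - 𝟙 ≡ (N + 1ℤ) * θ - (m + + 1) * 𝟙
    step₁ = solve-∀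
    step₂ : ∀ N m θ 𝟙 → (m + 1ℤ) * 𝟙 - N * θ + (𝟙 - θ) ≡ (m + + 1 + 1ℤ) * 𝟙 - (N + 1ℤ) * θ
    step₂ = solve-∀

  sturm-zero : ∀ n {N m} → N ≡ + (n ℕ.+ 1) → IsFloor (λ θ 𝟙 → N * θ) m →
    Pos (λ θ 𝟙 → 𝟙 - θ - (N * θ - m * 𝟙)) → sturm cf n ≡ 0
  sturm-zero n {N} {m} N≡ ⌊Nθ⌋ no-carry = sturm-≡ n 0 N≡ ⌊Nθ⌋ (mkFloor
    (nonNeg-resp (nonNeg+nonNeg (IsFloor.floor≤ ⌊Nθ⌋) (pos⇒nonNeg pos-θ)) λ θ 𝟙 → step₁ N m θ 𝟙)
    (pos-resp no-carry λ θ 𝟙 → step₂ N m θ 𝟙))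
    where
    step₁ : ∀ N m θ 𝟙 → N * θ - m * 𝟙 + θ ≡ (N + 1ℤ) * θ - (m + + 0) * 𝟙
    step₁ = solve-∀
    step₂ : ∀ N m θ 𝟙 → 𝟙 - θ - (N * θ - m * 𝟙) ≡ (m + + 0 + 1ℤ) * 𝟙 - (N + 1ℤ) * θ
    step₂ = solve-∀

  record Apart (D d k : ℤ) : Set where
    field
      θ-low  : Pos (λ θ 𝟙 → D * θ - 𝟙)
      θ-high : Pos (λ θ 𝟙 → D * (𝟙 - θ) - 𝟙)
      δ-low  : Pos (λ θ 𝟙 → D * (d * θ - k * 𝟙) - 𝟙)
      δ-high : Pos (λ θ 𝟙 → D * ((k + 1ℤ) * 𝟙 - d * θ) - 𝟙)

  module _ {D d k : ℤ} (apart : Apart D d k) where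

    open Apart apart

    private
      0<D-2 : 0ℤ < D - + 2
      0<D-2 = pos-const⁻¹ (pos-resp (pos+nonNeg θ-low (pos⇒nonNeg θ-high)) λ θ 𝟙 → solve (θ ∷ 𝟙 ∷ D ∷ []))

      0≤D-1 : 0ℤ ≤ D - 1ℤ
      0≤D-1 = subst (0ℤ ≤_) (step D) (+-mono-≤ (<⇒≤ 0<D-2) (+≤+ {0} {1} z≤n))
        where
        step : ∀ D → D - + 2 + 1ℤ ≡ D - 1ℤ
        step = solve-∀

      0<D : 0ℤ < D
      0<D = subst (0ℤ <_) (step D) (+-mono-<-≤ (+<+ {0} {1} (s≤s z≤n)) 0≤D-1)
        where
        step : ∀ D → 1ℤ + (D - 1ℤ) ≡ D
        step = solve-∀

    -- {N θ} ∈ (0, 1/D): no carry at N, but a carry at N + d since δ + θ ≥ 1.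
    separation-low : NonNeg (λ θ 𝟙 → (d + 1ℤ) * θ + (- k - 1ℤ) * 𝟙) →
      ∀ n n′ {N m} → N ≡ + (n ℕ.+ 1) → N + d ≡ + (n′ ℕ.+ 1) →
      Window (λ θ 𝟙 → 0ℤ * θ + 0ℤ * 𝟙) (λ θ 𝟙 → D * (N * θ - m * 𝟙)) → sturm cf n ≢ sturm cf n′
    separation-low δ+θ≥1 n n′ {N} {m} N≡ N+d≡ (mkWindow above below) sₙ≡sₙ′ =
      ℕ.0≢1+n (trans (sym no-carry) (trans sₙ≡sₙ′ carry))
      where
      Dφ<1 : Pos (λ θ 𝟙 → 𝟙 - D * (N * θ - m * 𝟙))
      Dφ<1 = pos-resp below λ θ 𝟙 → solve (θ ∷ 𝟙 ∷ D ∷ N ∷ m ∷ [])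
      φ>0 : Pos (λ θ 𝟙 → N * θ - m * 𝟙)
      φ>0 = pos-unscale 0<D (pos-resp above λ θ 𝟙 → solve (θ ∷ 𝟙 ∷ D ∷ N ∷ m ∷ []))
      δ>0 : Pos (λ θ 𝟙 → d * θ - k * 𝟙)
      δ>0 = pos-unscale 0<D (pos-resp (pos+nonNeg δ-low (pos⇒nonNeg pos-𝟙)) λ θ 𝟙 → solve (θ ∷ 𝟙 ∷ D ∷ d ∷ k ∷ []))
      ⌊Nθ⌋ : IsFloor (λ θ 𝟙 → N * θ) m
      ⌊Nθ⌋ = mkFloor (pos⇒nonNeg φ>0) (pos-unscale 0<D (pos-resp (pos+nonNeg Dφ<1 (nonNeg-const 0≤D-1))
        λ θ 𝟙 → solve (θ ∷ 𝟙 ∷ D ∷ N ∷ m ∷ [])))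
      ⌊N′θ⌋ : IsFloor (λ θ 𝟙 → (N + d) * θ) (m + k)
      ⌊N′θ⌋ = mkFloor
        (nonNeg-resp (nonNeg+nonNeg (pos⇒nonNeg φ>0) (pos⇒nonNeg δ>0)) λ θ 𝟙 → solve (θ ∷ 𝟙 ∷ d ∷ k ∷ N ∷ m ∷ []))
        (pos-unscale 0<D (pos-resp (pos+nonNeg δ-high (pos⇒nonNeg Dφ<1)) λ θ 𝟙 → solve (θ ∷ 𝟙 ∷ D ∷ d ∷ k ∷ N ∷ m ∷ [])))
      no-carry : sturm cf n ≡ 0
      no-carry = sturm-zero n N≡ ⌊Nθ⌋ (pos-unscale 0<D (pos-resp (pos+nonNeg θ-high (pos⇒nonNeg Dφ<1))
        λ θ 𝟙 → solve (θ ∷ 𝟙 ∷ D ∷ N ∷ m ∷ [])))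
      carry : sturm cf n′ ≡ 1
      carry = sturm-one n′ N+d≡ ⌊N′θ⌋ (nonNeg-resp (nonNeg+nonNeg (pos⇒nonNeg φ>0) δ+θ≥1)
        λ θ 𝟙 → solve (θ ∷ 𝟙 ∷ d ∷ k ∷ N ∷ m ∷ []))

    -- {N θ} ∈ (1 − 1/D, 1): a carry at N, but none at N + d since δ + θ < 1.
    separation-high : Pos (λ θ 𝟙 → - ((d + 1ℤ) * θ + (- k - 1ℤ) * 𝟙)) →
      ∀ n n′ {N m} → N ≡ + (n ℕ.+ 1) → N + d ≡ + (n′ ℕ.+ 1) →
      Window (λ θ 𝟙 → 0ℤ * θ + (D - 1ℤ) * 𝟙) (λ θ 𝟙 → D * (N * θ - m * 𝟙)) → sturm cf n ≢ sturm cf n′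
    separation-high δ+θ<1 n n′ {N} {m} N≡ N+d≡ (mkWindow above below) sₙ≡sₙ′ =
      ℕ.1+n≢0 (trans (sym carry) (trans sₙ≡sₙ′ no-carry))
      where
      φ<1 : Pos (λ θ 𝟙 → (m + 1ℤ) * 𝟙 - N * θ)
      φ<1 = pos-unscale 0<D (pos-resp below λ θ 𝟙 → solve (θ ∷ 𝟙 ∷ D ∷ N ∷ m ∷ []))
      ⌊Nθ⌋ : IsFloor (λ θ 𝟙 → N * θ) m
      ⌊Nθ⌋ = mkFloor (pos⇒nonNeg (pos-unscale 0<D (pos-resp (pos+nonNeg above (nonNeg-const 0≤D-1))
        λ θ 𝟙 → solve (θ ∷ 𝟙 ∷ D ∷ N ∷ m ∷ [])))) φ<1
      ⌊N′θ⌋ : IsFloor (λ θ 𝟙 → (N + d) * θ) (m + k + 1ℤ)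
      ⌊N′θ⌋ = mkFloor
        (pos⇒nonNeg (pos-unscale 0<D (pos-resp (pos+nonNeg above (pos⇒nonNeg δ-low))
          λ θ 𝟙 → solve (θ ∷ 𝟙 ∷ D ∷ d ∷ k ∷ N ∷ m ∷ []))))
        (pos-resp (pos+nonNeg φ<1 (nonNeg+nonNeg (pos⇒nonNeg δ+θ<1) (pos⇒nonNeg pos-θ)))
          λ θ 𝟙 → solve (θ ∷ 𝟙 ∷ d ∷ k ∷ N ∷ m ∷ []))
      carry : sturm cf n ≡ 1
      carry = sturm-one n N≡ ⌊Nθ⌋ (pos⇒nonNeg (pos-unscale 0<D (pos-resp (pos+nonNeg above (pos⇒nonNeg θ-low))
        λ θ 𝟙 → solve (θ ∷ 𝟙 ∷ D ∷ N ∷ m ∷ []))))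
      no-carry : sturm cf n′ ≡ 0
      no-carry = sturm-zero n′ N+d≡ ⌊N′θ⌋ (pos-resp (pos+nonNeg φ<1 (pos⇒nonNeg δ+θ<1))
        λ θ 𝟙 → solve (θ ∷ 𝟙 ∷ d ∷ k ∷ N ∷ m ∷ []))

    separation : Σ ℤ λ y₁ → Σ ℤ λ y₂ → ∀ n n′ {N m} → N ≡ + (n ℕ.+ 1) → N + d ≡ + (n′ ℕ.+ 1) →
      Window (λ θ 𝟙 → y₁ * θ + y₂ * 𝟙) (λ θ 𝟙 → D * (N * θ - m * 𝟙)) → sturm cf n ≢ sturm cf n′
    separation with sign-cases (d + 1ℤ) (- k - 1ℤ)
    ... | inj₁ δ+θ<1 = 0ℤ , D - 1ℤ , separation-high δ+θ<1
    ... | inj₂ δ+θ≥1 = 0ℤ , 0ℤ , separation-low δ+θ≥1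

module Diversity (B : ℕ) {cf : ℕ → ℕ} (icf : IsCF cf) (bnd : BoundedPQ B cf) where

  open import Data.Nat as ℕ using (z≤n; s≤s)
  import Data.Nat.Properties as ℕ
  open import Data.Integer hiding (suc)
  open import Data.Integer.Properties
  open import Data.Product using (Σ; _×_; _,_; proj₁; proj₂)
  open import Data.Sum using (_⊎_; inj₁; inj₂)
  open import Data.Empty using (⊥-elim)
  open import Data.List using (_∷_; [])
  open import Relation.Binary.PropositionalEquality
  open import Data.Integer.Tactic.RingSolver using (solve; solve-∀)
  import Data.Nat.Tactic.RingSolver as ℕ-Solver
  open Convergents
  open Sign
  open Forms icf
  open Approximation icf using (approximation; consecutive)
  open Density icf using (density)
  open SturmValues icf using (Apart; separation)

  G : ℕ → ℕ
  G r = 2 ℕ.* (B ℕ.+ 2) ℕ.* (B ℕ.+ 2) ℕ.* r ℕ.* r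

  private
    resolve-pos : ∀ {D x y} → 0ℤ ≤ D → Pos (λ θ 𝟙 → x * θ - y * 𝟙) →
      Pos (λ θ 𝟙 → D * (x * θ - y * 𝟙) - 𝟙) ⊎ Pos (λ θ 𝟙 → D * (y * 𝟙 - x * θ) - 𝟙) →
      Pos (λ θ 𝟙 → D * (x * θ - y * 𝟙) - 𝟙)
    resolve-pos _ _ (inj₁ bound) = bound
    resolve-pos {D} {x} {y} 0≤D g>0 (inj₂ wrong) = ⊥-elim (pos⇒¬nonNeg-neg wrong
      (nonNeg-resp (nonNeg+nonNeg (nonNeg-scale 0≤D (pos⇒nonNeg g>0)) (pos⇒nonNeg pos-𝟙)) λ θ 𝟙 → solve (θ ∷ 𝟙 ∷ D ∷ x ∷ y ∷ [])))

    resolve-neg : ∀ {D x y} → 0ℤ ≤ D → Pos (λ θ 𝟙 → y * 𝟙 - x * θ) →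
      Pos (λ θ 𝟙 → D * (x * θ - y * 𝟙) - 𝟙) ⊎ Pos (λ θ 𝟙 → D * (y * 𝟙 - x * θ) - 𝟙) →
      Pos (λ θ 𝟙 → D * (y * 𝟙 - x * θ) - 𝟙)
    resolve-neg _ _ (inj₂ bound) = bound
    resolve-neg {D} {x} {y} 0≤D g>0 (inj₁ wrong) = ⊥-elim (pos⇒¬nonNeg-neg wrong
      (nonNeg-resp (nonNeg+nonNeg (nonNeg-scale 0≤D (pos⇒nonNeg g>0)) (pos⇒nonNeg pos-𝟙)) λ θ 𝟙 → solve (θ ∷ 𝟙 ∷ D ∷ x ∷ y ∷ [])))

  apart-from-integers : ∀ {d} → 1 ℕ.≤ d → Apart ((+ B + + 2) * + d) (+ d) (+ floorMul cf d)
  apart-from-integers {d} d≥1 = record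
    { θ-low  = pos-resp (resolve-pos {D} {+ 1} {0ℤ} 0≤D (pos-resp pos-θ λ θ 𝟙 → θ-as-form θ 𝟙)
                          (approximation B bnd (s≤s z≤n) D≥ 0ℤ))
                 λ θ 𝟙 → θ-low-≡ D θ 𝟙
    ; θ-high = pos-resp (resolve-neg {D} {+ 1} {1ℤ} 0≤D (pos-resp pos-𝟙-θ λ θ 𝟙 → 𝟙-θ-as-form θ 𝟙)
                          (approximation B bnd (s≤s z≤n) D≥ 1ℤ))
                 λ θ 𝟙 → θ-high-≡ D θ 𝟙
    ; δ-low  = resolve-pos {D} {+ d} {k} 0≤D (proj₁ (floorMul-bounds d≥1)) (approximation B bnd d≥1 ≤-refl k)
    ; δ-high = resolve-neg {D} {+ d} {k + 1ℤ} 0≤D (proj₂ (floorMul-bounds d≥1)) (approximation B bnd d≥1 ≤-refl (k + 1ℤ))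
    }
    where
    D = (+ B + + 2) * + d
    k = + floorMul cf d
    0≤D : 0ℤ ≤ D
    0≤D = 0≤* {+ B + + 2} {+ d} (+≤+ z≤n) (+≤+ z≤n)
    D≥ : (+ B + + 2) * + 1 ≤ D
    D≥ = *-monoˡ-≤-nonNeg (+ B + + 2) {+ 1} {+ d} (+≤+ d≥1)
    θ-as-form : ∀ θ 𝟙 → θ ≡ + 1 * θ - 0ℤ * 𝟙
    θ-as-form = solve-∀
    𝟙-θ-as-form : ∀ θ 𝟙 → 𝟙 - θ ≡ 1ℤ * 𝟙 - + 1 * θ
    𝟙-θ-as-form = solve-∀
    θ-low-≡ : ∀ D θ 𝟙 → D * (+ 1 * θ - 0ℤ * 𝟙) - 𝟙 ≡ D * θ - 𝟙
    θ-low-≡ = solve-∀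
    θ-high-≡ : ∀ D θ 𝟙 → D * (1ℤ * 𝟙 - + 1 * θ) - 𝟙 ≡ D * (𝟙 - θ) - 𝟙
    θ-high-≡ = solve-∀

  private
    shift-window : ∀ {D R C y₁ y₂ i j} →
      Window (λ θ 𝟙 → (y₁ - D * C) * θ + y₂ * 𝟙) (λ θ 𝟙 → D * R * (i * θ - j * 𝟙)) →
      Window (λ θ 𝟙 → y₁ * θ + y₂ * 𝟙) (λ θ 𝟙 → D * ((R * i + C) * θ - R * j * 𝟙))
    shift-window {D} {R} {C} {y₁} {y₂} {i} {j} (mkWindow above below) = mkWindow
      (pos-resp above λ θ 𝟙 → solve (θ ∷ 𝟙 ∷ D ∷ R ∷ C ∷ y₁ ∷ y₂ ∷ i ∷ j ∷ []))
      (pos-resp below λ θ 𝟙 → solve (θ ∷ 𝟙 ∷ D ∷ R ∷ C ∷ y₁ ∷ y₂ ∷ i ∷ j ∷ []))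

    -- Here the constant of G comes in: (B + 3) M ≤ G r < q′ ≤ (B + 1) q.
    spacing : ∀ {r d} → d ℕ.≤ r → ∀ {K} → G r ℕ.< denom cf (2 ℕ.+ K) →
      let M = (B ℕ.+ 2) ℕ.* d ℕ.* r ; q = denom cf (1 ℕ.+ K) ; q′ = denom cf (2 ℕ.+ K) in
      M ℕ.* q′ ℕ.+ 2 ℕ.* M ℕ.* q ℕ.≤ q ℕ.* q′
    spacing {r} {d} d≤r {K} G<q′ = begin
      M ℕ.* q′ ℕ.+ 2 ℕ.* M ℕ.* q            ≤⟨ ℕ.+-monoˡ-≤ _ (ℕ.*-monoʳ-≤ M (denom-bounded icf B bnd K)) ⟩
      M ℕ.* ((B ℕ.+ 1) ℕ.* q) ℕ.+ 2 ℕ.* M ℕ.* q ≡⟨ collect B M q ⟩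
      (B ℕ.+ 3) ℕ.* M ℕ.* q                ≤⟨ ℕ.*-monoˡ-≤ q (ℕ.≤-trans [B+3]M≤G (ℕ.<⇒≤ G<q′)) ⟩
      q′ ℕ.* q                             ≡⟨ ℕ.*-comm q′ q ⟩
      q ℕ.* q′                             ∎
      where
      open ℕ.≤-Reasoning
      M = (B ℕ.+ 2) ℕ.* d ℕ.* r
      q = denom cf (1 ℕ.+ K)
      q′ = denom cf (2 ℕ.+ K)
      collect : ∀ B M q → M ℕ.* ((B ℕ.+ 1) ℕ.* q) ℕ.+ 2 ℕ.* M ℕ.* q ≡ (B ℕ.+ 3) ℕ.* M ℕ.* q
      collect = ℕ-Solver.solve-∀
      regroup : ∀ B r → 2 ℕ.* (B ℕ.+ 2) ℕ.* ((B ℕ.+ 2) ℕ.* r ℕ.* r) ≡ 2 ℕ.* (B ℕ.+ 2) ℕ.* (B ℕ.+ 2) ℕ.* r ℕ.* r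
      regroup = ℕ-Solver.solve-∀
      B+3≤2[B+2] : B ℕ.+ 3 ℕ.≤ 2 ℕ.* (B ℕ.+ 2)
      B+3≤2[B+2] = ℕ.≤-trans (ℕ.m≤m+n (B ℕ.+ 3) (B ℕ.+ 1)) (ℕ.≤-reflexive (two B))
        where
        two : ∀ B → B ℕ.+ 3 ℕ.+ (B ℕ.+ 1) ≡ 2 ℕ.* (B ℕ.+ 2)
        two = ℕ-Solver.solve-∀
      [B+3]M≤G : (B ℕ.+ 3) ℕ.* M ℕ.≤ G r
      [B+3]M≤G = ℕ.≤-trans (ℕ.*-mono-≤ B+3≤2[B+2] (ℕ.*-monoˡ-≤ r (ℕ.*-monoʳ-≤ (B ℕ.+ 2) d≤r)))
                           (ℕ.≤-reflexive (regroup B r))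

  dense-residues : ∀ {r d} → 1 ℕ.≤ d → d ℕ.≤ r → ∀ c y₁ y₂ → Σ ℕ λ i → i ℕ.≤ G r × Σ ℤ λ m →
    Window (λ θ 𝟙 → y₁ * θ + y₂ * 𝟙) (λ θ 𝟙 → (+ B + + 2) * + d * (+ (r ℕ.* i ℕ.+ c) * θ - m * 𝟙))
  dense-residues {r} {d} d≥1 d≤r c y₁ y₂ =
    let K , q≤G , G<q′ = denom-bracket icf G≥1
        i , i<q , j , window = density ⦃ ℕ.>-nonZero (denom-pos icf K) ⦄ ⦃ ℕ.>-nonZero (denom-pos icf (ℕ.suc K)) ⦄
                                 (consecutive (ℕ.suc K)) M ⦃ ℕ.>-nonZero M≥1 ⦄
                                 (spacing d≤r {K} G<q′) (y₁ - D * + c) y₂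
    in i , ℕ.<⇒≤ (ℕ.<-≤-trans i<q q≤G) , + r * j ,
       subst (λ z → Window (λ θ 𝟙 → y₁ * θ + y₂ * 𝟙) (λ θ 𝟙 → D * (z * θ - + r * j * 𝟙))) (N≡ i)
         (shift-window {D} {+ r} {+ c} {y₁} {y₂} {+ i} {j}
           (subst (λ z → Window (λ θ 𝟙 → (y₁ - D * + c) * θ + y₂ * 𝟙) (λ θ 𝟙 → z * (+ i * θ - j * 𝟙))) M≡Dr window))
    where
    D = (+ B + + 2) * + d
    M = (B ℕ.+ 2) ℕ.* d ℕ.* r
    1≤B+2 : 1 ℕ.≤ B ℕ.+ 2
    1≤B+2 = ℕ.≤-trans (s≤s z≤n) (ℕ.m≤n+m 2 B)
    r≥1 = ℕ.≤-trans d≥1 d≤r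
    G≥1 : 1 ℕ.≤ G r
    G≥1 = ℕ.*-mono-≤ (ℕ.*-mono-≤ (ℕ.*-mono-≤ (ℕ.*-mono-≤ {1} {2} (s≤s z≤n) 1≤B+2) 1≤B+2) r≥1) r≥1
    M≥1 : 1 ℕ.≤ M
    M≥1 = ℕ.*-mono-≤ (ℕ.*-mono-≤ 1≤B+2 d≥1) r≥1
    M≡Dr : + M ≡ D * + r
    M≡Dr = trans (pos-* ((B ℕ.+ 2) ℕ.* d) r) (cong (_* + r) (trans (pos-* (B ℕ.+ 2) d) (cong (_* + d) (pos-+ B 2))))
    N≡ : ∀ i → + r * + i + + c ≡ + (r ℕ.* i ℕ.+ c)
    N≡ i = sym (trans (pos-+ (r ℕ.* i) c) (cong (_+ + c) (pos-* r i)))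

  index-≡ : ∀ x a → + (x ℕ.+ (a ℕ.+ 1)) ≡ + (x ℕ.+ a ℕ.+ 1)
  index-≡ x a = cong +_ (sym (ℕ.+-assoc x a 1))

  index+d-≡ : ∀ x {a b} → a ℕ.≤ b → + (x ℕ.+ (a ℕ.+ 1)) + + (b ℕ.∸ a) ≡ + (x ℕ.+ b ℕ.+ 1)
  index+d-≡ x {a} {b} a≤b = trans (sym (pos-+ (x ℕ.+ (a ℕ.+ 1)) (b ℕ.∸ a)))
    (cong +_ (trans (regroup x a (b ℕ.∸ a)) (cong (λ z → x ℕ.+ z ℕ.+ 1) (ℕ.m+[n∸m]≡n a≤b))))
    where
    regroup : ∀ x a e → x ℕ.+ (a ℕ.+ 1) ℕ.+ e ≡ x ℕ.+ (a ℕ.+ e) ℕ.+ 1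
    regroup = ℕ-Solver.solve-∀

open import Data.Nat using (_+_; _*_; _∸_; _≤_)
open import Data.Nat.Properties using (m<n⇒0<n∸m; m∸n≤m; ≤-trans; <⇒≤)
open import Data.Product using (_,_)

-- 1 ≤ B already follows from IsCF cf and BoundedPQ B cf.
theorem9 : (B : ℕ) → 1 ≤ B → (cf : ℕ → ℕ) → IsCF cf → BoundedPQ B cf →
    IsDiversityMeasure (λ r → 2 * (B + 2) * (B + 2) * r * r) (sturm cf)
theorem9 B _ cf icf bnd r a b a<b b<r =
  let y₁ , y₂ , separated = separation (apart-from-integers d≥1)
      i , i≤G , m , window = dense-residues d≥1 d≤r (a + 1) y₁ y₂
  in i , i≤G , separated (r * i + a) (r * i + b) {m = m} (index-≡ (r * i) a) (index+d-≡ (r * i) (<⇒≤ a<b)) window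
  where
  open Diversity B icf bnd
  open SturmValues icf using (separation)
  d = b ∸ a
  d≥1 = m<n⇒0<n∸m a<b
  d≤r = ≤-trans (m∸n≤m b a) (<⇒≤ b<r)
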